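{- For $G\in\mathcal G_{xy}^\circ$, $\widehat G^+\in\mathcal E$ if and only if $G\in\mathcal C^\circ(\widehat g^+)$, $\theta(G)>0$, and $\widehat g(G/xy)<\widehat g^+(G)$.
   Context: All graphs are finite and simple; after contracting an edge, parallel edges are replaced by single edges. The Euler genus $\widehat g(G)$ is the minimum Euler genus of a surface into which $G$ embeds. $\mathcal E$ is the class of graphs $H$ (without terminals) that are critical for Euler genus $k$ for some $k\ge0$, i.e. $\widehat g(H)>k$ and $\widehat g(H-e)\le k$, $\widehat g(H/e)\le k$ for every edge $e$. $\mathcal G_{xy}$ is the class of simple graphs with two distinguished vertices $x,y$ (terminals); $\mathcal G_{xy}^\circ$ the subclass with $x,y$ non-adjacent; $\widehat G$ denotes the underlying graph without terminals. The set $\mathcal M(G)$ of minor-operations consists of deletion of any edge and contraction of any edge other than $xy$ (contracting an edge incident with a terminal yields a terminal); $\mu G$ is the result. $G^+$ is $G$ with edge $xy$ added, $\widehat G^+$ its underlying graph, $\widehat g^+(G)=\widehat g(G^+)$, $\theta(G)=\widehat g^+(G)-\widehat g(G)$. $G/xy$ is the simple graph obtained from $G$ by identifying $x$ and $y$. $\mathcal C^\circ(\widehat g^+)$ is the class of $G\in\mathcal G_{xy}^\circ$ with $\widehat g^+(\mu G)<\widehat g^+(G)$ for all $\mu\in\mathcal M(G)$. -}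

module Defs where

open import Data.Nat using (ℕ; zero; suc; _+_; _*_; _∸_; _≤_; _≤ᵇ_; _<ᵇ_; _/_)
open import Data.Bool using (Bool; true; false; _∧_; _∨_; not; _xor_; if_then_else_)
open import Data.Fin using (Fin; toℕ; _≟_)
open import Data.Product using (Σ; ∃; _×_; _,_)
open import Data.Sum using (_⊎_)
open import Relation.Nullary using (¬_)
open import Relation.Nullary.Decidable using (⌊_⌋)
open import Relation.Binary.PropositionalEquality using (_≡_)

countF : ∀ {n} → (Fin n → Bool) → ℕ
countF {zero}  f = 0
countF {suc n} f = (if f Fin.zero then 1 else 0) + countF (λ i → f (Fin.suc i))

sumF : ∀ {n} → (Fin n → ℕ) → ℕ
sumF {zero}  f = 0
sumF {suc n} f = f Fin.zero + sumF (λ i → f (Fin.suc i))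

anyF : ∀ {n} → (Fin n → Bool) → Bool
anyF {zero}  f = false
anyF {suc n} f = f Fin.zero ∨ anyF (λ i → f (Fin.suc i))

allF : ∀ {n} → (Fin n → Bool) → Bool
allF {zero}  f = true
allF {suc n} f = f Fin.zero ∧ allF (λ i → f (Fin.suc i))

allBelow : ℕ → (ℕ → Bool) → Bool
allBelow zero    p = true
allBelow (suc k) p = allBelow k p ∧ p k

iter : ∀ {A : Set} → (A → A) → ℕ → A → A
iter f zero    a = a
iter f (suc k) a = f (iter f k a)

_==_ : ∀ {n} → Fin n → Fin n → Bool
a == b = ⌊ a ≟ b ⌋

-- Keeping the ambient Fin n
-- fixed lets contraction simply remove a vertex from V.

record Graph (n : ℕ) : Set where
  constructor graph
  field
    V : Fin n → Bool
    E : Fin n → Fin n → Bool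
open Graph public

record WF {n : ℕ} (G : Graph n) : Set where
  field
    sym     : ∀ u v → E G u v ≡ E G v u
    irrefl  : ∀ u → E G u u ≡ false
    inV     : ∀ u v → E G u v ≡ true → V G u ≡ true

deleteEdge : ∀ {n} → Graph n → Fin n → Fin n → Graph n
deleteEdge G a b = graph (V G)
  (λ u v → E G u v ∧ not ((u == a ∧ v == b) ∨ (u == b ∧ v == a)))

-- identify b into a (a survives, b disappears); parallel edges merge
-- automatically and loops are discarded, so the result is simple.
-- Contraction of an edge ab is merge G a b.
merge : ∀ {n} → Graph n → Fin n → Fin n → Graph n
merge G a b = graph (λ u → V G u ∧ not (u == b))
  (λ u v → not (u == b) ∧ not (v == b) ∧ not (u == v) ∧
           (E G u v ∨ (u == a ∧ E G b v) ∨ (v == a ∧ E G u b)))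

addEdge : ∀ {n} → Graph n → Fin n → Fin n → Graph n
addEdge G a b = graph (V G)
  (λ u v → E G u v ∨ (u == a ∧ v == b) ∨ (u == b ∧ v == a))

-- Euler genus via signed rotation systems (Mohar–Thomassen, Ch. 3).

record RotSys {n : ℕ} (G : Graph n) : Set where
  field
    ρ  : Fin n → Fin n → Fin n     -- ρ u v : successor of neighbour v around u
    ρ' : Fin n → Fin n → Fin n
    λs : Fin n → Fin n → Bool      -- edge signature (true = twisted)
    ρ-nb   : ∀ u v → E G u v ≡ true → E G u (ρ u v) ≡ true
    ρ'-nb  : ∀ u v → E G u v ≡ true → E G u (ρ' u v) ≡ true
    ρ'ρ    : ∀ u v → E G u v ≡ true → ρ' u (ρ u v) ≡ v
    ρρ'    : ∀ u v → E G u v ≡ true → ρ u (ρ' u v) ≡ v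
    cyclic : ∀ u v w → E G u v ≡ true → E G u w ≡ true →
             ∃ λ k → iter (ρ u) k v ≡ w
    λ-sym  : ∀ u v → λs u v ≡ λs v u
open RotSys public

Flag : ℕ → Set
Flag n = Fin n × Fin n × Bool

-- one step of the face-tracing procedure: traverse edge uv, flip the local
-- orientation if the edge is twisted, then take the next edge at v
faceStep : ∀ {n} {G : Graph n} → RotSys G → Flag n → Flag n
faceStep R (u , v , s) =
  let s' = s xor λs R u v in
  (v , (if s' then ρ R v u else ρ' R v u) , s')

code : ∀ {n} → Flag n → ℕ
code {n} (u , v , s) = (toℕ u * n + toℕ v) * 2 + (if s then 1 else 0)

orbitMin : ∀ {n} {G : Graph n} → RotSys G → Flag n → Bool
orbitMin {n} R f = allBelow (2 * n * n) (λ k → code f ≤ᵇ code (iter (faceStep R) k f))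

-- number of faceStep-orbits on flags (u,v,s) with uv an edge
flagOrbits : ∀ {n} {G : Graph n} → RotSys G → ℕ
flagOrbits {G = G} R =
  sumF λ u → sumF λ v → countF {2} λ s →
    E G u v ∧ orbitMin R (u , v , (if s == Fin.zero then false else true))

isolated : ∀ {n} → Graph n → Fin n → Bool
isolated G u = V G u ∧ not (anyF (E G u))

-- each face is traced twice (once in each direction); isolated vertices
-- form one face each
faces : ∀ {n} {G : Graph n} → RotSys G → ℕ
faces {G = G} R = flagOrbits R / 2 + countF (isolated G)

nV : ∀ {n} → Graph n → ℕ
nV G = countF (V G)

nE : ∀ {n} → Graph n → ℕ
nE G = sumF λ u → countF λ v → (toℕ u <ᵇ toℕ v) ∧ E G u v

reachIn : ∀ {n} → Graph n → ℕ → Fin n → Fin n → Bool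
reachIn G zero    u v = u == v
reachIn G (suc k) u v = reachIn G k u v ∨ anyF (λ w → reachIn G k u w ∧ E G w v)

-- number of connected components (least-index representatives)
nC : ∀ {n} → Graph n → ℕ
nC {n} G = countF λ u → V G u ∧
  allF (λ v → not (reachIn G n u v) ∨ (toℕ u ≤ᵇ toℕ v))

-- Euler genus of the embedding: Σ over components (2 - V_i + E_i - F_i)
eulerGenusOf : ∀ {n} {G : Graph n} → RotSys G → ℕ
eulerGenusOf {G = G} R = (2 * nC G + nE G) ∸ (nV G + faces R)

EmbedsIn : ∀ {n} → Graph n → ℕ → Set
EmbedsIn G k = Σ (RotSys G) λ R → eulerGenusOf R ≤ k

_<ᵍ_ : ∀ {n m} → Graph n → Graph m → Set
A <ᵍ B = ∃ λ k → EmbedsIn A k × ¬ EmbedsIn B k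

-- The class ℰ: critical for Euler genus k for some k

Critical : ∀ {n} → Graph n → Set
Critical G = ∃ λ k → ¬ EmbedsIn G k ×
  (∀ a b → E G a b ≡ true → EmbedsIn (deleteEdge G a b) k × EmbedsIn (merge G a b) k)

record TGraph (n : ℕ) : Set where
  constructor tgraph
  field
    under : Graph n
    x y   : Fin n
open TGraph public

InGxy : ∀ {n} → TGraph n → Set
InGxy G = WF (under G) × ¬ (x G ≡ y G) × V (under G) (x G) ≡ true × V (under G) (y G) ≡ true

InGxy° : ∀ {n} → TGraph n → Set
InGxy° G = InGxy G × E (under G) (x G) (y G) ≡ false

isTerminal : ∀ {n} → TGraph n → Fin n → Bool
isTerminal G v = (v == x G) ∨ (v == y G)

data MinorOp {n : ℕ} (G : TGraph n) : Set where
  del : (a b : Fin n) → E (under G) a b ≡ true → MinorOp G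
  con : (a b : Fin n) → E (under G) a b ≡ true →
        ¬ ((a ≡ x G × b ≡ y G) ⊎ (a ≡ y G × b ≡ x G)) → MinorOp G

-- μG.  Contracting an edge with a terminal end keeps the terminal
-- (so the contracted vertex is a terminal).
applyOp : ∀ {n} {G : TGraph n} → MinorOp G → TGraph n
applyOp {G = G} (del a b _)   = tgraph (deleteEdge (under G) a b) (x G) (y G)
applyOp {G = G} (con a b _ _) =
  tgraph (if isTerminal G b then merge (under G) b a else merge (under G) a b) (x G) (y G)

plusU : ∀ {n} → TGraph n → Graph n
plusU G = addEdge (under G) (x G) (y G)

identXY : ∀ {n} → TGraph n → Graph n
identXY G = merge (under G) (x G) (y G)

InC° : ∀ {n} → TGraph n → Set
InC° G = InGxy° G × (∀ (μ : MinorOp G) → plusU (applyOp μ) <ᵍ plusU G)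

-- θ(G) > 0, i.e. ĝ(G) < ĝ⁺(G)
θPos : ∀ {n} → TGraph n → Set
θPos G = under G <ᵍ plusU G

{-# OPTIONS --safe #-}
module Submission where

-- Every edge of Ĝ⁺ other than xy is an edge ab of G, and deleting or contracting ab in Ĝ⁺ gives
-- the graph obtained from G by the corresponding minor-operation followed by adding xy, while
-- deleting xy gives Ĝ and contracting it gives G/xy.  So the right-hand side says that every
-- one-edge minor of Ĝ⁺ has smaller Euler genus than Ĝ⁺.  The witnesses k may depend on the minor,
-- but there are finitely many edges and "Ĝ⁺ does not embed in Euler genus k" is closed under
-- maxima, so one k serves all of them, which is criticality.
--
-- The identifications hold only up to renaming vertices: contracting ab in Ĝ⁺ keeps a, while the
-- minor-operation keeps a terminal b, and the two results differ by swapping a and b.  The bulk of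
-- the work is therefore that Euler genus, computed from a rotation system, is invariant under
-- relabelling.  Components and faces are counted by their least members for fixed rankings of
-- vertices and flags; relabelling changes the ranking, and the number of least members of the
-- classes of an equivalence relation on a finite set does not depend on the injective ranking.

open import Defs
open import Data.Nat as ℕ using (ℕ; zero; suc; _+_; _*_; _∸_; _≤_; _<_; _≤ᵇ_; _<ᵇ_; _⊔_; z≤n)
open import Data.Nat.Properties hiding (_≟_)
open import Data.Nat.DivMod using (_%_; m≡m%n+[m/n]*n; m%n<n)
open import Data.Nat.Induction using (<-wellFounded)
open import Data.Bool as Bool using (Bool; true; false; _∧_; _∨_; not; _xor_; if_then_else_)
import Data.Bool.Properties as Boolₚ
open import Data.Fin as Fin using (Fin; toℕ)
import Data.Fin.Properties as Finₚ
open import Data.Fin.Permutation as Perm using (Permutation′; _⟨$⟩ʳ_; _⟨$⟩ˡ_; inverseˡ; inverseʳ; _∘ₚ_)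
open import Data.Product using (∃; _×_; _,_; proj₁; proj₂)
open import Data.Product.Properties using (≡-dec)
open import Data.Sum as Sum using (_⊎_; inj₁; inj₂)
open import Data.Empty using (⊥)
open import Function using (id; _∘_; _⇔_; mk⇔; Injective; Equivalence)
open import Induction.WellFounded using (Acc; acc)
open import Relation.Nullary using (Dec; yes; no; ¬_; contradiction)
open import Relation.Nullary.Decidable using (⌊_⌋; map′; _×-dec_; _⊎-dec_; dec-true; dec-false)
open import Relation.Unary using (Decidable)
open import Relation.Binary.Definitions using (DecidableEquality; tri<; tri≈; tri>)
open import Relation.Binary.PropositionalEquality
open import Algebra.Properties.CommutativeSemigroup +-commutativeSemigroup using (interchange)
import Algebra.Properties.CommutativeMonoid.Sum as CommutativeMonoidSum

∧-intro : ∀ {a b} → a ≡ true → b ≡ true → a ∧ b ≡ true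
∧-intro refl refl = refl

∧-elimˡ : ∀ {a b} → a ∧ b ≡ true → a ≡ true
∧-elimˡ {true} _ = refl

∧-elimʳ : ∀ {a b} → a ∧ b ≡ true → b ≡ true
∧-elimʳ {true} p = p

∨-introˡ : ∀ {a b} → a ≡ true → a ∨ b ≡ true
∨-introˡ refl = refl

∨-introʳ : ∀ {a b} → b ≡ true → a ∨ b ≡ true
∨-introʳ {true} _ = refl
∨-introʳ {false} p = p

∨-elim : ∀ {a b} → a ∨ b ≡ true → a ≡ true ⊎ b ≡ true
∨-elim {true} _ = inj₁ refl
∨-elim {false} p = inj₂ p

not-true : ∀ {a} → a ≡ false → not a ≡ true
not-true refl = refl

not-true⁻ : ∀ {a} → not a ≡ true → a ≡ false
not-true⁻ {false} _ = refl

true≢false : ∀ {a} → a ≡ true → a ≢ false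
true≢false refl ()

≢true : ∀ {a} → a ≢ true → a ≡ false
≢true {true} p = contradiction refl p
≢true {false} _ = refl

implies-true : ∀ {a b} → (a ≡ true → b ≡ true) → not a ∨ b ≡ true
implies-true {false} _ = refl
implies-true {true} h = h refl

implies-true⁻ : ∀ {a b} → not a ∨ b ≡ true → a ≡ true → b ≡ true
implies-true⁻ e refl = e

bool-ext : ∀ {a b} → (a ≡ true → b ≡ true) → (b ≡ true → a ≡ true) → a ≡ b
bool-ext {true} to _ = sym (to refl)
bool-ext {false} {true} _ from = from refl
bool-ext {false} {false} _ _ = refl

∧-cong-if : ∀ a {b c} → (a ≡ true → b ≡ c) → a ∧ b ≡ a ∧ c
∧-cong-if true h = h refl
∧-cong-if false h = refl

indicator : Bool → ℕ
indicator b = if b then 1 else 0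

indicator-mono : ∀ {a b} → (a ≡ true → b ≡ true) → indicator a ≤ indicator b
indicator-mono {false} _ = z≤n
indicator-mono {true} h rewrite h refl = ≤-refl

_⊆ᵇ_ : ∀ {A : Set} → (A → Bool) → (A → Bool) → Set
P ⊆ᵇ Q = ∀ {u} → P u ≡ true → Q u ≡ true

isYes⇒ : ∀ {P : Set} {d : Dec P} → ⌊ d ⌋ ≡ true → P
isYes⇒ {d = yes p} _ = p

⇒isYes : ∀ {P : Set} (d : Dec P) → P → ⌊ d ⌋ ≡ true
⇒isYes (yes _) _ = refl
⇒isYes (no ¬p) p = contradiction p ¬p

⇒isNo : ∀ {P : Set} (d : Dec P) → ¬ P → ⌊ d ⌋ ≡ false
⇒isNo (yes p) ¬p = contradiction p ¬p
⇒isNo (no _) _ = refl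

module _ {n : ℕ} where

  ==⇒≡ : {u v : Fin n} → (u == v) ≡ true → u ≡ v
  ==⇒≡ = isYes⇒

  ==-refl : (u : Fin n) → (u == u) ≡ true
  ==-refl u = ⇒isYes (u Fin.≟ u) refl

  ≢⇒==-false : {u v : Fin n} → u ≢ v → (u == v) ≡ false
  ≢⇒==-false {u} {v} = ⇒isNo (u Fin.≟ v)

  ==-sym : (u v : Fin n) → (u == v) ≡ (v == u)
  ==-sym u v = bool-ext (λ e → ⇒isYes (v Fin.≟ u) (sym (==⇒≡ e)))
                        (λ e → ⇒isYes (u Fin.≟ v) (sym (==⇒≡ e)))

==-injective : ∀ {m n} (f : Fin m → Fin n) → Injective _≡_ _≡_ f → ∀ u v → (f u == f v) ≡ (u == v)
==-injective f inj u v = bool-ext (λ e → ⇒isYes (u Fin.≟ v) (inj (==⇒≡ e)))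
                                  (λ e → ⇒isYes (f u Fin.≟ f v) (cong f (==⇒≡ e)))

≤ᵇ-true⇒≤ : ∀ {m n} → (m ≤ᵇ n) ≡ true → m ≤ n
≤ᵇ-true⇒≤ {m} {n} e = ≤ᵇ⇒≤ m n (Equivalence.from Boolₚ.T-≡ e)

≤⇒≤ᵇ-true : ∀ {m n} → m ≤ n → (m ≤ᵇ n) ≡ true
≤⇒≤ᵇ-true m≤n = Equivalence.to Boolₚ.T-≡ (≤⇒≤ᵇ m≤n)

<ᵇ-true⇒< : ∀ {m n} → (m <ᵇ n) ≡ true → m < n
<ᵇ-true⇒< {m} {n} e = <ᵇ⇒< m n (Equivalence.from Boolₚ.T-≡ e)

<⇒<ᵇ-true : ∀ {m n} → m < n → (m <ᵇ n) ≡ true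
<⇒<ᵇ-true m<n = Equivalence.to Boolₚ.T-≡ (<⇒<ᵇ m<n)

private module ∑ = CommutativeMonoidSum +-0-commutativeMonoid

sumF≡sum : ∀ {n} (f : Fin n → ℕ) → sumF f ≡ ∑.sum f
sumF≡sum {zero} f = refl
sumF≡sum {suc n} f = cong (f Fin.zero +_) (sumF≡sum (f ∘ Fin.suc))

sumF-cong : ∀ {n} {f g : Fin n → ℕ} → (∀ i → f i ≡ g i) → sumF f ≡ sumF g
sumF-cong {zero} _ = refl
sumF-cong {suc n} f≗g = cong₂ _+_ (f≗g Fin.zero) (sumF-cong (f≗g ∘ Fin.suc))

sumF-mono : ∀ {n} {f g : Fin n → ℕ} → (∀ i → f i ≤ g i) → sumF f ≤ sumF g
sumF-mono {zero} _ = z≤n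
sumF-mono {suc n} f≤g = +-mono-≤ (f≤g Fin.zero) (sumF-mono (f≤g ∘ Fin.suc))

sumF-distrib-+ : ∀ {n} (f g : Fin n → ℕ) → sumF (λ i → f i + g i) ≡ sumF f + sumF g
sumF-distrib-+ f g = begin
  sumF (λ i → f i + g i)    ≡⟨ sumF≡sum (λ i → f i + g i) ⟩
  ∑.sum (λ i → f i + g i)   ≡⟨ ∑.∑-distrib-+ f g ⟩
  ∑.sum f + ∑.sum g         ≡⟨ cong₂ _+_ (sumF≡sum f) (sumF≡sum g) ⟨
  sumF f + sumF g           ∎
  where open ≡-Reasoning

sumF-comm : ∀ {m n} (h : Fin m → Fin n → ℕ) →
            sumF (λ i → sumF (λ j → h i j)) ≡ sumF (λ j → sumF (λ i → h i j))
sumF-comm h = begin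
  sumF (λ i → sumF (λ j → h i j))     ≡⟨ sumF-cong (λ i → sumF≡sum (h i)) ⟩
  sumF (λ i → ∑.sum (λ j → h i j))    ≡⟨ sumF≡sum (λ i → ∑.sum (h i)) ⟩
  ∑.sum (λ i → ∑.sum (λ j → h i j))   ≡⟨ ∑.∑-comm h ⟩
  ∑.sum (λ j → ∑.sum (λ i → h i j))   ≡⟨ sumF≡sum (λ j → ∑.sum (λ i → h i j)) ⟨
  sumF (λ j → ∑.sum (λ i → h i j))    ≡⟨ sumF-cong (λ j → sumF≡sum (λ i → h i j)) ⟨
  sumF (λ j → sumF (λ i → h i j))     ∎
  where open ≡-Reasoning

sumF-permute : ∀ {n} (π : Permutation′ n) (f : Fin n → ℕ) → sumF (f ∘ (π ⟨$⟩ʳ_)) ≡ sumF f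
sumF-permute π f = begin
  sumF (f ∘ (π ⟨$⟩ʳ_))    ≡⟨ sumF≡sum (f ∘ (π ⟨$⟩ʳ_)) ⟩
  ∑.sum (f ∘ (π ⟨$⟩ʳ_))   ≡⟨ ∑.sum-permute f π ⟨
  ∑.sum f                 ≡⟨ sumF≡sum f ⟨
  sumF f                  ∎
  where open ≡-Reasoning

sumF-point : ∀ {n} (a : Fin n) k → sumF (λ i → if i == a then k else 0) ≡ k
sumF-point {suc n} Fin.zero k = trans (cong (k +_) (sumF-zero n)) (+-identityʳ k)
  where
  sumF-zero : ∀ m → sumF {m} (λ _ → 0) ≡ 0
  sumF-zero zero = refl
  sumF-zero (suc m) = sumF-zero m
sumF-point {suc n} (Fin.suc a) k =
  trans (sumF-cong λ i → cong (if_then k else 0) (==-injective Fin.suc Finₚ.suc-injective i a)) (sumF-point a k)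

countF≡sumF : ∀ {n} (f : Fin n → Bool) → countF f ≡ sumF (indicator ∘ f)
countF≡sumF {zero} f = refl
countF≡sumF {suc n} f = cong (indicator (f Fin.zero) +_) (countF≡sumF (f ∘ Fin.suc))

countF-cong : ∀ {n} {f g : Fin n → Bool} → (∀ i → f i ≡ g i) → countF f ≡ countF g
countF-cong {f = f} {g} f≗g = begin
  countF f                ≡⟨ countF≡sumF f ⟩
  sumF (indicator ∘ f)    ≡⟨ sumF-cong (cong indicator ∘ f≗g) ⟩
  sumF (indicator ∘ g)    ≡⟨ countF≡sumF g ⟨
  countF g                ∎
  where open ≡-Reasoning

countF-permute : ∀ {n} (π : Permutation′ n) (f : Fin n → Bool) → countF (f ∘ (π ⟨$⟩ʳ_)) ≡ countF f
countF-permute π f = begin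
  countF (f ∘ (π ⟨$⟩ʳ_))              ≡⟨ countF≡sumF (f ∘ (π ⟨$⟩ʳ_)) ⟩
  sumF (indicator ∘ f ∘ (π ⟨$⟩ʳ_))    ≡⟨ sumF-permute π (indicator ∘ f) ⟩
  sumF (indicator ∘ f)                ≡⟨ countF≡sumF f ⟨
  countF f                            ∎
  where open ≡-Reasoning

anyF⇒∃ : ∀ {n} {f : Fin n → Bool} → anyF f ≡ true → ∃ λ i → f i ≡ true
anyF⇒∃ {suc n} {f} e with ∨-elim {f Fin.zero} e
... | inj₁ f0 = Fin.zero , f0
... | inj₂ rest = let (i , fi) = anyF⇒∃ rest in Fin.suc i , fi

∃⇒anyF : ∀ {n} {f : Fin n → Bool} i → f i ≡ true → anyF f ≡ true
∃⇒anyF Fin.zero fi = ∨-introˡ fi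
∃⇒anyF {f = f} (Fin.suc i) fi = ∨-introʳ {f Fin.zero} (∃⇒anyF i fi)

anyF-cong : ∀ {n} {f g : Fin n → Bool} → (∀ i → f i ≡ g i) → anyF f ≡ anyF g
anyF-cong f≗g = bool-ext (λ e → let (i , fi) = anyF⇒∃ e in ∃⇒anyF i (trans (sym (f≗g i)) fi))
                         (λ e → let (i , gi) = anyF⇒∃ e in ∃⇒anyF i (trans (f≗g i) gi))

anyF-permute : ∀ {n} (π : Permutation′ n) (f : Fin n → Bool) → anyF (f ∘ (π ⟨$⟩ʳ_)) ≡ anyF f
anyF-permute π f = bool-ext
  (λ e → let (i , fπi) = anyF⇒∃ e in ∃⇒anyF (π ⟨$⟩ʳ i) fπi)
  (λ e → let (i , fi) = anyF⇒∃ e in ∃⇒anyF (π ⟨$⟩ˡ i) (subst (λ j → f j ≡ true) (sym (inverseʳ π)) fi))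

allF⇒∀ : ∀ {n} {f : Fin n → Bool} → allF f ≡ true → ∀ i → f i ≡ true
allF⇒∀ e Fin.zero = ∧-elimˡ e
allF⇒∀ {f = f} e (Fin.suc i) = allF⇒∀ (∧-elimʳ {f Fin.zero} e) i

∀⇒allF : ∀ {n} {f : Fin n → Bool} → (∀ i → f i ≡ true) → allF f ≡ true
∀⇒allF {zero} _ = refl
∀⇒allF {suc n} all = ∧-intro (all Fin.zero) (∀⇒allF (all ∘ Fin.suc))

allF-cong : ∀ {n} {f g : Fin n → Bool} → (∀ i → f i ≡ g i) → allF f ≡ allF g
allF-cong f≗g = bool-ext (λ e → ∀⇒allF λ i → trans (sym (f≗g i)) (allF⇒∀ e i))
                         (λ e → ∀⇒allF λ i → trans (f≗g i) (allF⇒∀ e i))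

allF-permute : ∀ {n} (π : Permutation′ n) (f : Fin n → Bool) → allF (f ∘ (π ⟨$⟩ʳ_)) ≡ allF f
allF-permute π f = bool-ext
  (λ e → ∀⇒allF λ i → subst (λ j → f j ≡ true) (inverseʳ π) (allF⇒∀ e (π ⟨$⟩ˡ i)))
  (λ e → ∀⇒allF λ i → allF⇒∀ e (π ⟨$⟩ʳ i))

allBelow⇒∀< : ∀ {k p} → allBelow k p ≡ true → ∀ {j} → j < k → p j ≡ true
allBelow⇒∀< {suc k} {p} e {j} j<1+k with m≤n⇒m<n∨m≡n (ℕ.s≤s⁻¹ j<1+k)
... | inj₁ j<k = allBelow⇒∀< (∧-elimˡ e) j<k
... | inj₂ refl = ∧-elimʳ {allBelow j p} e

∀<⇒allBelow : ∀ {k p} → (∀ {j} → j < k → p j ≡ true) → allBelow k p ≡ true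
∀<⇒allBelow {zero} _ = refl
∀<⇒allBelow {suc k} all = ∧-intro (∀<⇒allBelow (all ∘ m<n⇒m<1+n)) (all ≤-refl)

anyBelow : ℕ → (ℕ → Bool) → Bool
anyBelow zero    p = false
anyBelow (suc k) p = anyBelow k p ∨ p k

anyBelow⇒∃< : ∀ {k p} → anyBelow k p ≡ true → ∃ λ j → j < k × p j ≡ true
anyBelow⇒∃< {suc k} {p} e with ∨-elim {anyBelow k p} e
... | inj₁ below = let (j , j<k , pj) = anyBelow⇒∃< below in j , m<n⇒m<1+n j<k , pj
... | inj₂ pk = k , ≤-refl , pk

∃<⇒anyBelow : ∀ {k p j} → j < k → p j ≡ true → anyBelow k p ≡ true
∃<⇒anyBelow {suc k} {p} {j} j<1+k pj with m≤n⇒m<n∨m≡n (ℕ.s≤s⁻¹ j<1+k)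
... | inj₁ j<k = ∨-introˡ (∃<⇒anyBelow j<k pj)
... | inj₂ refl = ∨-introʳ {anyBelow j p} pj

allBelow-cong : ∀ {k p q} → (∀ j → p j ≡ q j) → allBelow k p ≡ allBelow k q
allBelow-cong {zero} _ = refl
allBelow-cong {suc k} p≗q = cong₂ _∧_ (allBelow-cong {k} p≗q) (p≗q k)

-- Finite types and least members of equivalence classes

record Finite (A : Set) : Set₁ where
  field
    _≟_       : DecidableEquality A
    sum       : (A → ℕ) → ℕ
    sum-cong  : ∀ {f g} → (∀ a → f a ≡ g a) → sum f ≡ sum g
    sum-mono  : ∀ {f g} → (∀ a → f a ≤ g a) → sum f ≤ sum g
    sum-+     : ∀ f g → sum (λ a → f a + g a) ≡ sum f + sum g
    sum-point : ∀ a k → sum (λ b → if ⌊ b ≟ a ⌋ then k else 0) ≡ k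
    search    : ∀ {P : A → Set} → Decidable P → Dec (∃ P)

  count : (A → Bool) → ℕ
  count P = sum (indicator ∘ P)

  count-cong : ∀ {P Q} → (∀ a → P a ≡ Q a) → count P ≡ count Q
  count-cong P≗Q = sum-cong (cong indicator ∘ P≗Q)

  count-insert : ∀ {P Q} a → (∀ b → b ≢ a → P b ≡ Q b) → P a ≡ true → Q a ≡ false →
                 count P ≡ suc (count Q)
  count-insert {P} {Q} a P≗Q Pa Qa = begin
    count P                                                   ≡⟨ sum-cong pointwise ⟩
    sum (λ b → indicator (Q b) + (if ⌊ b ≟ a ⌋ then 1 else 0))  ≡⟨ sum-+ _ _ ⟩
    count Q + sum (λ b → if ⌊ b ≟ a ⌋ then 1 else 0)            ≡⟨ cong (count Q +_) (sum-point a 1) ⟩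
    count Q + 1                                               ≡⟨ +-comm (count Q) 1 ⟩
    suc (count Q)                                             ∎
    where
    open ≡-Reasoning
    pointwise : ∀ b → indicator (P b) ≡ indicator (Q b) + (if ⌊ b ≟ a ⌋ then 1 else 0)
    pointwise b with b ≟ a
    ... | yes refl rewrite Pa | Qa = refl
    ... | no b≢a rewrite P≗Q b b≢a = sym (+-identityʳ _)

  count-< : ∀ {P Q} a → Q ⊆ᵇ P → P a ≡ true → Q a ≡ false → count Q < count P
  count-< {P} {Q} a Q⊆P Pa Qa = begin-strict
    count Q                                                   <⟨ n<1+n _ ⟩
    suc (count Q)                                             ≡⟨ +-comm 1 (count Q) ⟩
    count Q + 1                                               ≡⟨ cong (count Q +_) (sum-point a 1) ⟨
    count Q + sum (λ b → if ⌊ b ≟ a ⌋ then 1 else 0)            ≡⟨ sum-+ _ _ ⟨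
    sum (λ b → indicator (Q b) + (if ⌊ b ≟ a ⌋ then 1 else 0))  ≤⟨ sum-mono pointwise ⟩
    count P                                                   ∎
    where
    open ≤-Reasoning
    pointwise : ∀ b → indicator (Q b) + (if ⌊ b ≟ a ⌋ then 1 else 0) ≤ indicator (P b)
    pointwise b with b ≟ a
    ... | yes refl rewrite Pa | Qa = ≤-refl
    ... | no _ = ≤-trans (≤-reflexive (+-identityʳ _)) (indicator-mono Q⊆P)

  argmin : ∀ (P : A → Bool) (r : A → ℕ) {a} → P a ≡ true →
           ∃ λ m → P m ≡ true × ∀ {b} → P b ≡ true → r m ≤ r b
  argmin P r {a} Pa = go a Pa (<-wellFounded (r a))
    where
    go : ∀ a → P a ≡ true → Acc _<_ (r a) → ∃ λ m → P m ≡ true × ∀ {b} → P b ≡ true → r m ≤ r b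
    go a Pa (acc smaller) with search (λ b → P b Bool.≟ true ×-dec r b <? r a)
    ... | yes (b , Pb , rb<ra) = go b Pb (smaller rb<ra)
    ... | no none = a , Pa , λ Pb → ≮⇒≥ λ rb<ra → none (_ , Pb , rb<ra)

Fin-finite : ∀ n → Finite (Fin n)
Fin-finite n = record
  { _≟_ = Fin._≟_
  ; sum = sumF
  ; sum-cong = sumF-cong
  ; sum-mono = sumF-mono
  ; sum-+ = sumF-distrib-+
  ; sum-point = sumF-point
  ; search = Finₚ.any?
  }

Bool-finite : Finite Bool
Bool-finite = record
  { _≟_ = Bool._≟_
  ; sum = λ f → f false + f true
  ; sum-cong = λ f≗g → cong₂ _+_ (f≗g false) (f≗g true)
  ; sum-mono = λ f≤g → +-mono-≤ (f≤g false) (f≤g true)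
  ; sum-+ = λ f g → interchange (f false) (g false) (f true) (g true)
  ; sum-point = point
  ; search = λ P? → map′ witness (λ { (false , p) → inj₁ p ; (true , p) → inj₂ p }) (P? false ⊎-dec P? true)
  }
  where
  point : ∀ a k → (if ⌊ false Bool.≟ a ⌋ then k else 0) + (if ⌊ true Bool.≟ a ⌋ then k else 0) ≡ k
  point false k = +-identityʳ k
  point true k = refl
  witness : ∀ {P : Bool → Set} → P false ⊎ P true → ∃ P
  witness (inj₁ p) = false , p
  witness (inj₂ p) = true , p

×-finite : ∀ {A B} → Finite A → Finite B → Finite (A × B)
×-finite {A} {B} finA finB = record
  { _≟_ = _≟×_
  ; sum = sum×
  ; sum-cong = λ f≗g → A.sum-cong λ a → B.sum-cong λ b → f≗g (a , b)
  ; sum-mono = λ f≤g → A.sum-mono λ a → B.sum-mono λ b → f≤g (a , b)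
  ; sum-+ = λ f g → trans (A.sum-cong λ a → B.sum-+ _ _) (A.sum-+ _ _)
  ; sum-point = point
  ; search = λ P? → map′ (λ (a , b , p) → (a , b) , p) (λ ((a , b) , p) → a , b , p)
                         (A.search λ a → B.search λ b → P? (a , b))
  }
  where
  module A = Finite finA
  module B = Finite finB
  _≟×_ : DecidableEquality (A × B)
  _≟×_ = ≡-dec A._≟_ B._≟_
  sum× : (A × B → ℕ) → ℕ
  sum× f = A.sum λ a → B.sum λ b → f (a , b)
  ≟×-split : ∀ a a′ b b′ → ⌊ (a , b) ≟× (a′ , b′) ⌋ ≡ ⌊ a A.≟ a′ ⌋ ∧ ⌊ b B.≟ b′ ⌋
  ≟×-split a a′ b b′ = bool-ext
    (λ e → ∧-intro (⇒isYes (a A.≟ a′) (cong proj₁ (isYes⇒ e))) (⇒isYes (b B.≟ b′) (cong proj₂ (isYes⇒ e))))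
    (λ e → ⇒isYes ((a , b) ≟× (a′ , b′))
                  (cong₂ _,_ (isYes⇒ {d = a A.≟ a′} (∧-elimˡ e)) (isYes⇒ (∧-elimʳ {⌊ a A.≟ a′ ⌋} e))))
  point : ∀ p k → sum× (λ q → if ⌊ q ≟× p ⌋ then k else 0) ≡ k
  point (a₀ , b₀) k = trans (A.sum-cong inner) (A.sum-point a₀ k)
    where
    inner : ∀ a → B.sum (λ b → if ⌊ (a , b) ≟× (a₀ , b₀) ⌋ then k else 0) ≡ (if ⌊ a A.≟ a₀ ⌋ then k else 0)
    inner a with a A.≟ a₀ | ≟×-split a a₀
    ... | yes refl | split = trans (B.sum-cong λ b → cong (if_then k else 0) (split b b₀)) (B.sum-point b₀ k)
    ... | no _     | split = trans (B.sum-cong λ b → trans (cong (if_then k else 0) (split b b₀))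
                                                           (sym (Boolₚ.if-eta ⌊ b B.≟ b₀ ⌋)))
                                   (B.sum-point b₀ 0)

record IsEquivalenceOn {A : Set} (B : A → Bool) (_~_ : A → A → Bool) : Set where
  field
    reflexive  : ∀ {u} → B u ≡ true → (u ~ u) ≡ true
    symmetric  : ∀ {u v} → B u ≡ true → (u ~ v) ≡ true → (v ~ u) ≡ true
    transitive : ∀ {u v w} → B u ≡ true → (u ~ v) ≡ true → (v ~ w) ≡ true → (u ~ w) ≡ true
    closed     : ∀ {u v} → B u ≡ true → (u ~ v) ≡ true → B v ≡ true

module ClassMinima {A : Set} (finite : Finite A) {B : A → Bool} {_~_ : A → A → Bool}
                   (equiv : IsEquivalenceOn B _~_) where
  open Finite finite
  open IsEquivalenceOn equiv
  open Equivalence using (to; from)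

  SelectsMinima : (A → ℕ) → (A → Bool) → Set
  SelectsMinima r m = ∀ u → m u ≡ true ⇔ (B u ≡ true × ∀ {v} → (u ~ v) ≡ true → r u ≤ r v)

  private
    Saturated : (A → Bool) → Set
    Saturated D = D ⊆ᵇ B × (∀ {u v} → D u ≡ true → (u ~ v) ≡ true → D v ≡ true)

    module RemoveClass {D} (sat : Saturated D) {a} (Da : D a ≡ true) where
      Ba : B a ≡ true
      Ba = proj₁ sat Da

      D′ : A → Bool
      D′ u = D u ∧ not (a ~ u)

      D′-saturated : Saturated D′
      D′-saturated = (λ D′u → proj₁ sat (∧-elimˡ D′u))
                , λ {u} {v} D′u u~v → ∧-intro (proj₂ sat (∧-elimˡ D′u) u~v) (not-true (≢true λ a~v →
                    true≢false (transitive Ba a~v (symmetric (proj₁ sat (∧-elimˡ D′u)) u~v))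
                               (not-true⁻ (∧-elimʳ {D u} D′u))))

      D′-smaller : count D′ < count D
      D′-smaller = count-< a ∧-elimˡ Da (trans (cong (λ b → D a ∧ not b) (reflexive Ba)) (Boolₚ.∧-zeroʳ (D a)))

      count-minima : ∀ {r m} → Injective _≡_ _≡_ r → SelectsMinima r m →
                     count (λ u → D u ∧ m u) ≡ suc (count (λ u → D′ u ∧ m u))
      count-minima {r} {m} r-inj selects
        with c , Dc∧a~c , c-least′ ← argmin (λ v → D v ∧ (a ~ v)) r (∧-intro Da (reflexive Ba))
        = count-insert c others c-selected c-removed
        where
        Dc : D c ≡ true
        Dc = ∧-elimˡ Dc∧a~c
        a~c : (a ~ c) ≡ true
        a~c = ∧-elimʳ {D c} Dc∧a~c
        c-least : ∀ {v} → D v ≡ true → (a ~ v) ≡ true → r c ≤ r v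
        c-least Dv a~v = c-least′ (∧-intro Dv a~v)

        c-selected : (D c ∧ m c) ≡ true
        c-selected = ∧-intro Dc (from (selects c) (proj₁ sat Dc , λ c~v →
          let a~v = transitive Ba a~c c~v in c-least (proj₂ sat Da a~v) a~v))

        c-removed : (D′ c ∧ m c) ≡ false
        c-removed rewrite a~c = cong (_∧ m c) (Boolₚ.∧-zeroʳ (D c))

        others : ∀ u → u ≢ c → (D u ∧ m u) ≡ (D′ u ∧ m u)
        others u u≢c with a ~ u in a~u
        ... | false = cong (_∧ m u) (sym (Boolₚ.∧-identityʳ (D u)))
        ... | true = trans (≢true λ Du∧mu →
          let Du = ∧-elimˡ Du∧mu
              (Bu , u-least) = to (selects u) (∧-elimʳ {D u} Du∧mu)
          in u≢c (r-inj (≤-antisym (u-least (transitive Bu (symmetric Ba a~u) a~c)) (c-least Du a~u))))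
          (sym (cong (_∧ m u) (Boolₚ.∧-zeroʳ (D u))))

  -- Induction over unions of classes: removing one class removes exactly one selected element,
  -- whatever the ranking.
  count-minima-invariant : ∀ {r₁ r₂ m₁ m₂} → Injective _≡_ _≡_ r₁ → Injective _≡_ _≡_ r₂ →
                           SelectsMinima r₁ m₁ → SelectsMinima r₂ m₂ → count m₁ ≡ count m₂
  count-minima-invariant {r₁} {r₂} {m₁} {m₂} r₁-inj r₂-inj sel₁ sel₂ = begin
    count m₁                   ≡⟨ count-cong (within-B sel₁) ⟩
    count (λ u → B u ∧ m₁ u)   ≡⟨ go B (id , closed) (<-wellFounded _) ⟩
    count (λ u → B u ∧ m₂ u)   ≡⟨ count-cong (within-B sel₂) ⟨
    count m₂                   ∎
    where
    open ≡-Reasoning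
    within-B : ∀ {r m} → SelectsMinima r m → ∀ u → m u ≡ B u ∧ m u
    within-B sel u = bool-ext (λ mu → ∧-intro (proj₁ (to (sel u) mu)) mu) (∧-elimʳ {B u})
    go : ∀ D → Saturated D → Acc _<_ (count D) → count (λ u → D u ∧ m₁ u) ≡ count (λ u → D u ∧ m₂ u)
    go D sat (acc smaller) with search (λ a → D a Bool.≟ true)
    ... | no empty = count-cong λ u →
      let ¬Du = ≢true λ Du → empty (u , Du) in trans (cong (_∧ m₁ u) ¬Du) (sym (cong (_∧ m₂ u) ¬Du))
    ... | yes (a , Da) = begin
      count (λ u → D u ∧ m₁ u)          ≡⟨ count-minima r₁-inj sel₁ ⟩
      suc (count (λ u → D′ u ∧ m₁ u))   ≡⟨ cong suc (go D′ D′-saturated (smaller D′-smaller)) ⟩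
      suc (count (λ u → D′ u ∧ m₂ u))   ≡⟨ count-minima r₂-inj sel₂ ⟨
      count (λ u → D u ∧ m₂ u)          ∎
      where open RemoveClass sat Da

-- Connected components

module _ {n} (S : ℕ → Fin n → Bool) (grow : ∀ {k} → S k ⊆ᵇ S (suc k))
         (settle : ∀ {k} → S (suc k) ⊆ᵇ S k → S (suc (suc k)) ⊆ᵇ S (suc k)) where
  open Finite (Fin-finite n) using (count; count-<; search)

  private
    Stationary : ℕ → Set
    Stationary j = S (suc j) ⊆ᵇ S j

    count-≤ : ∀ {m} (P : Fin m → Bool) → Finite.count (Fin-finite m) P ≤ m
    count-≤ {zero} P = z≤n
    count-≤ {suc m} P = +-mono-≤ (indicator-mono {P Fin.zero} {true} λ _ → refl) (count-≤ (P ∘ Fin.suc))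

    stationary-or-growing : ∀ k → (∃ λ j → j < k × Stationary j) ⊎ k ≤ count (S k)
    stationary-or-growing zero = inj₂ z≤n
    stationary-or-growing (suc k) with stationary-or-growing k
    ... | inj₁ (j , j<k , st) = inj₁ (j , m<n⇒m<1+n j<k , st)
    ... | inj₂ k≤count with search (λ u → (S (suc k) u ∧ not (S k u)) Bool.≟ true)
    ...   | yes (u , new) = inj₂ (≤-<-trans k≤count (count-< u grow (∧-elimˡ new) (not-true⁻ (∧-elimʳ {S (suc k) u} new))))
    ...   | no none = inj₁ (k , ≤-refl , old)
      where
      old : Stationary k
      old {u} S′u with S k u in Su
      ... | true = refl
      ... | false = contradiction (u , ∧-intro S′u (cong not Su)) none

    eventually-stationary : ∃ λ j → j ≤ n × Stationary j
    eventually-stationary with stationary-or-growing (suc n)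
    ... | inj₁ (j , j<1+n , st) = j , ℕ.s≤s⁻¹ j<1+n , st
    ... | inj₂ 1+n≤count = contradiction (count-≤ (S (suc n))) (<⇒≱ 1+n≤count)

    stays-stationary : ∀ {j} → Stationary j → ∀ d → Stationary (d + j)
    stays-stationary st zero = st
    stays-stationary st (suc d) = settle (stays-stationary st d)

    shrinks-to : ∀ {j} → Stationary j → ∀ d → S (d + j) ⊆ᵇ S j
    shrinks-to st zero = id
    shrinks-to st (suc d) = shrinks-to st d ∘ stays-stationary st d

    grows-to : ∀ {j} d → S j ⊆ᵇ S (d + j)
    grows-to zero = id
    grows-to (suc d) = grow ∘ grows-to d

  -- While the chain grows strictly it gains an element at every step, so it stops growing by step n.
  chain-stationary : ∀ m → S (m + n) ⊆ᵇ S n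
  chain-stationary m {u} with eventually-stationary
  ... | j , j≤n , st = subst (λ i → S i u ≡ true) (m∸n+n≡m j≤n) ∘ grows-to (n ∸ j)
                     ∘ shrinks-to st (m + (n ∸ j))
                     ∘ subst (λ i → S i u ≡ true) (sym m+[n∸j]+j≡m+n)
    where
    m+[n∸j]+j≡m+n : m + (n ∸ j) + j ≡ m + n
    m+[n∸j]+j≡m+n = trans (+-assoc m (n ∸ j) j) (cong (m +_) (m∸n+n≡m j≤n))

module Reachability {n} {H : Graph n} (wf : WF H) where
  open WF wf using (inV)

  reach : ℕ → Fin n → Fin n → Bool
  reach = reachIn H

  reach-suc : ∀ k {u v} → reach k u v ≡ true → reach (suc k) u v ≡ true
  reach-suc k = ∨-introˡ

  reach-snoc : ∀ k {u w v} → reach k u w ≡ true → E H w v ≡ true → reach (suc k) u v ≡ true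
  reach-snoc k {u} {w} {v} r e = ∨-introʳ {reach k u v} (∃⇒anyF {f = λ w → reach k u w ∧ E H w v} w (∧-intro r e))

  reach-last : ∀ k {u v} → reach (suc k) u v ≡ true →
               reach k u v ≡ true ⊎ ∃ λ w → reach k u w ≡ true × E H w v ≡ true
  reach-last k {u} {v} r with ∨-elim {reach k u v} r
  ... | inj₁ r′ = inj₁ r′
  ... | inj₂ r′ = let (w , r∧e) = anyF⇒∃ {f = λ w → reach k u w ∧ E H w v} r′
                  in inj₂ (w , ∧-elimˡ r∧e , ∧-elimʳ {reach k u w} r∧e)

  reach-refl : ∀ k u → reach k u u ≡ true
  reach-refl zero u = ==-refl u
  reach-refl (suc k) u = reach-suc k (reach-refl k u)

  reach-cons : ∀ k {u w v} → E H u w ≡ true → reach k w v ≡ true → reach (suc k) u v ≡ true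
  reach-cons zero {u} e r rewrite ==⇒≡ r = reach-snoc zero (==-refl u) e
  reach-cons (suc k) e r with reach-last k r
  ... | inj₁ r′ = reach-suc (suc k) (reach-cons k e r′)
  ... | inj₂ (w′ , r′ , e′) = reach-snoc (suc k) (reach-cons k e r′) e′

  reach-sym : ∀ k {u v} → reach k u v ≡ true → reach k v u ≡ true
  reach-sym zero {u} {v} r = trans (==-sym v u) r
  reach-sym (suc k) r with reach-last k r
  ... | inj₁ r′ = reach-suc k (reach-sym k r′)
  ... | inj₂ (w , r′ , e) = reach-cons k (trans (sym (WF.sym wf _ _)) e) (reach-sym k r′)

  reach-++ : ∀ k l {u v w} → reach k u v ≡ true → reach l v w ≡ true → reach (l + k) u w ≡ true
  reach-++ k zero r r′ rewrite ==⇒≡ r′ = r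
  reach-++ k (suc l) r r′ with reach-last l r′
  ... | inj₁ r″ = reach-suc (l + k) (reach-++ k l r r″)
  ... | inj₂ (w , r″ , e) = reach-snoc (l + k) (reach-++ k l r r″) e

  reach-V : ∀ k {u v} → V H u ≡ true → reach k u v ≡ true → V H v ≡ true
  reach-V zero Vu r rewrite ==⇒≡ r = Vu
  reach-V (suc k) Vu r with reach-last k r
  ... | inj₁ r′ = reach-V k Vu r′
  ... | inj₂ (w , _ , e) = inV _ _ (trans (WF.sym wf _ _) e)

  reach-stable : ∀ m {u v} → reach (m + n) u v ≡ true → reach n u v ≡ true
  reach-stable m {u} = chain-stationary (λ k → reach k u) (λ {k} → reach-suc k) (λ {k} → settle {k}) m
    where
    settle : ∀ {k} → reach (suc k) u ⊆ᵇ reach k u → reach (suc (suc k)) u ⊆ᵇ reach (suc k) u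
    settle {k} back r with reach-last (suc k) r
    ... | inj₁ r′ = r′
    ... | inj₂ (w , r′ , e) = reach-snoc k (back r′) e

  reach-equivalence : IsEquivalenceOn (V H) (reach n)
  reach-equivalence = record
    { reflexive = λ {u} _ → reach-refl n u
    ; symmetric = λ _ → reach-sym n
    ; transitive = λ _ r r′ → reach-stable n (reach-++ n n r r′)
    ; closed = reach-V n
    }

  componentLeast : (Fin n → ℕ) → Fin n → Bool
  componentLeast r u = V H u ∧ allF (λ v → not (reach n u v) ∨ (r u ≤ᵇ r v))

  open ClassMinima (Fin-finite n) reach-equivalence public using (SelectsMinima)

  componentLeast-selects : ∀ r → SelectsMinima r (componentLeast r)
  componentLeast-selects r u = mk⇔
    (λ sel → ∧-elimˡ sel , λ {v} r → ≤ᵇ-true⇒≤ (implies-true⁻ (allF⇒∀ (∧-elimʳ {V H u} sel) v) r))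
    (λ (Vu , least) → ∧-intro Vu (∀⇒allF λ v → implies-true (≤⇒≤ᵇ-true ∘ least {v})))

  nC≡count : nC H ≡ Finite.count (Fin-finite n) (componentLeast toℕ)
  nC≡count = countF≡sumF (componentLeast toℕ)

-- Face orbits

Flag-finite : ∀ n → Finite (Flag n)
Flag-finite n = ×-finite (Fin-finite n) (×-finite (Fin-finite n) Bool-finite)

iter-+ : ∀ {A : Set} (f : A → A) k l {a} → iter f (k + l) a ≡ iter f k (iter f l a)
iter-+ f zero l = refl
iter-+ f (suc k) l = cong f (iter-+ f k l)

iter-multiple : ∀ {A : Set} (f : A → A) {p a} → iter f p a ≡ a → ∀ c → iter f (c * p) a ≡ a
iter-multiple f period zero = refl
iter-multiple f {p} period (suc c) = trans (iter-+ f p (c * p)) (trans (cong (iter f p) (iter-multiple f period c)) period)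

iter-mod : ∀ {A : Set} (f : A → A) {p a} → iter f (suc p) a ≡ a → ∀ m → iter f (m % suc p) a ≡ iter f m a
iter-mod f {p} {a} period m = begin
  iter f (m % suc p) a                                ≡⟨ cong (iter f (m % suc p)) (iter-multiple f period (m ℕ./ suc p)) ⟨
  iter f (m % suc p) (iter f (m ℕ./ suc p * suc p) a) ≡⟨ iter-+ f (m % suc p) _ ⟨
  iter f (m % suc p + m ℕ./ suc p * suc p) a          ≡⟨ cong (λ k → iter f k a) (m≡m%n+[m/n]*n m (suc p)) ⟨
  iter f m a                                          ∎
  where open ≡-Reasoning

iter-return : ∀ {A : Set} (f : A → A) {p a} → iter f (suc p) a ≡ a → ∀ k → iter f (k * suc p ∸ k) (iter f k a) ≡ a
iter-return f {p} {a} period k = begin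
  iter f (k * suc p ∸ k) (iter f k a)    ≡⟨ iter-+ f (k * suc p ∸ k) k ⟨
  iter f (k * suc p ∸ k + k) a           ≡⟨ cong (λ m → iter f m a) (m∸n+n≡m (m≤m*n k (suc p))) ⟩
  iter f (k * suc p) a                   ≡⟨ iter-multiple f period k ⟩
  a                                      ∎
  where open ≡-Reasoning

xor-cancelʳ : ∀ {s t} l → s xor l ≡ t xor l → s ≡ t
xor-cancelʳ {false} {false} _ _ = refl
xor-cancelʳ {true}  {true}  _ _ = refl
xor-cancelʳ {false} {true}  l e = contradiction e (Boolₚ.not-¬ refl)
xor-cancelʳ {true}  {false} l e = contradiction (sym e) (Boolₚ.not-¬ refl)

bit : Bool → Fin 2
bit s = if s then Fin.suc Fin.zero else Fin.zero

encode : ∀ {n} → Flag n → Fin (n * n * 2)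
encode (u , v , s) = Fin.combine (Fin.combine u v) (bit s)

toℕ-encode : ∀ {n} (f : Flag n) → toℕ (encode f) ≡ code f
toℕ-encode {n} (u , v , s) = begin
  toℕ (Fin.combine (Fin.combine u v) (bit s))    ≡⟨ Finₚ.toℕ-combine (Fin.combine u v) (bit s) ⟩
  2 * toℕ (Fin.combine u v) + toℕ (bit s)        ≡⟨ cong₂ (λ c b → 2 * c + b) (Finₚ.toℕ-combine u v) (toℕ-bit s) ⟩
  2 * (n * toℕ u + toℕ v) + indicator s          ≡⟨ cong (_+ indicator s) (*-comm 2 (n * toℕ u + toℕ v)) ⟩
  (n * toℕ u + toℕ v) * 2 + indicator s          ≡⟨ cong (λ c → (c + toℕ v) * 2 + indicator s) (*-comm n (toℕ u)) ⟩
  (toℕ u * n + toℕ v) * 2 + indicator s          ∎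
  where
  open ≡-Reasoning
  toℕ-bit : ∀ s → toℕ (bit s) ≡ indicator s
  toℕ-bit false = refl
  toℕ-bit true = refl

encode-injective : ∀ {n} → Injective _≡_ _≡_ (encode {n})
encode-injective {x = u , v , s} {u′ , v′ , s′} e
  with Finₚ.combine-injective (Fin.combine u v) (bit s) (Fin.combine u′ v′) (bit s′) e
... | uv≡u′v′ , bit≡bit′ with Finₚ.combine-injective u v u′ v′ uv≡u′v′
...   | refl , refl = cong (λ s → u , v , s) (bit-injective s s′ bit≡bit′)
  where
  bit-injective : ∀ s s′ → bit s ≡ bit s′ → s ≡ s′
  bit-injective false false _ = refl
  bit-injective true true _ = refl

code-injective : ∀ {n} → Injective _≡_ _≡_ (code {n})
code-injective {x = f} {g} e = encode-injective (Finₚ.toℕ-injective (trans (toℕ-encode f) (trans e (sym (toℕ-encode g)))))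

module FaceOrbits {n} {H : Graph n} (wf : WF H) (R : RotSys H) where
  open Finite (Flag-finite n) using (_≟_)

  step : Flag n → Flag n
  step = faceStep R

  Dart : Flag n → Bool
  Dart (u , v , _) = E H u v

  private
    rotate : Bool → Fin n → Fin n → Fin n
    rotate b v u = if b then ρ R v u else ρ' R v u

    rotate-neighbour : ∀ b {v u} → E H v u ≡ true → E H v (rotate b v u) ≡ true
    rotate-neighbour true = ρ-nb R _ _
    rotate-neighbour false = ρ'-nb R _ _

    rotate-injective : ∀ b {v u u′} → E H v u ≡ true → E H v u′ ≡ true → rotate b v u ≡ rotate b v u′ → u ≡ u′
    rotate-injective true {v} e e′ eq = trans (sym (ρ'ρ R v _ e)) (trans (cong (ρ' R v) eq) (ρ'ρ R v _ e′))
    rotate-injective false {v} e e′ eq = trans (sym (ρρ' R v _ e)) (trans (cong (ρ R v) eq) (ρρ' R v _ e′))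

    reverse : ∀ {u v} → E H u v ≡ true → E H v u ≡ true
    reverse {u} {v} e = trans (WF.sym wf v u) e

  step-dart : ∀ {f} → Dart f ≡ true → Dart (step f) ≡ true
  step-dart {u , v , s} e = rotate-neighbour (s xor λs R u v) (reverse e)

  iter-dart : ∀ k {f} → Dart f ≡ true → Dart (iter step k f) ≡ true
  iter-dart zero d = d
  iter-dart (suc k) {f} d = step-dart {iter step k f} (iter-dart k d)

  step-injective : ∀ {f g} → Dart f ≡ true → Dart g ≡ true → step f ≡ step g → f ≡ g
  step-injective {u , v , s} {u′ , v′ , t} e e′ eq with cong proj₁ eq
  ... | refl = cong₂ _,_ u≡u′ (cong (v ,_) (xor-cancelʳ (λs R u v)
                 (trans same-twist (cong (λ w → t xor λs R w v) (sym u≡u′)))))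
    where
    same-twist : s xor λs R u v ≡ t xor λs R u′ v
    same-twist = cong (proj₂ ∘ proj₂) eq
    same-rotation : rotate (s xor λs R u v) v u ≡ rotate (s xor λs R u v) v u′
    same-rotation = trans (cong (proj₁ ∘ proj₂) eq) (cong (λ b → rotate b v u′) (sym same-twist))
    u≡u′ : u ≡ u′
    u≡u′ = rotate-injective (s xor λs R u v) (reverse e) (reverse e′) same-rotation

  cancel-prefix : ∀ i d {f} → Dart f ≡ true → iter step (i + d) f ≡ iter step i f → iter step d f ≡ f
  cancel-prefix zero d _ e = e
  cancel-prefix (suc i) d {f} df e = cancel-prefix i d df (step-injective (iter-dart (i + d) df) (iter-dart i df) e)

  period-bound : ℕ
  period-bound = 2 * n * n

  -- Pigeonhole gives two equal iterates among the first n * n * 2 + 1; as step is injective on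
  -- darts, cancelling their common prefix shows that f itself recurs.
  periodic : ∀ {f} → Dart f ≡ true → ∃ λ p → suc p ≤ period-bound × iter step (suc p) f ≡ f
  periodic {f} df with Finₚ.pigeonhole (n<1+n (n * n * 2)) (λ i → encode (iter step (toℕ i) f))
  ... | i , j , i<j , same with m≤n⇒∃[o]m+o≡n i<j
  ...   | p , i+1+p≡j = p , bound , cancel-prefix (toℕ i) (suc p) df returns
    where
    returns : iter step (toℕ i + suc p) f ≡ iter step (toℕ i) f
    returns = trans (cong (λ k → iter step k f) (trans (+-suc (toℕ i) p) i+1+p≡j)) (sym (encode-injective same))
    bound : suc p ≤ period-bound
    bound = begin
      suc p                ≤⟨ m≤n+m (suc p) (toℕ i) ⟩
      toℕ i + suc p        ≡⟨ trans (+-suc (toℕ i) p) i+1+p≡j ⟩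
      toℕ j                ≤⟨ ℕ.s≤s⁻¹ (Finₚ.toℕ<n j) ⟩
      n * n * 2            ≡⟨ *-comm (n * n) 2 ⟩
      2 * (n * n)          ≡⟨ *-assoc 2 n n ⟨
      period-bound                    ∎
      where open ≤-Reasoning

  orbit : Flag n → Flag n → Bool
  orbit f g = anyBelow period-bound (λ k → ⌊ iter step k f ≟ g ⌋)

  orbit⇒iter : ∀ {f g} → orbit f g ≡ true → ∃ λ k → iter step k f ≡ g
  orbit⇒iter {f} {g} o =
    let (k , _ , found) = anyBelow⇒∃< {period-bound} {λ k → ⌊ iter step k f ≟ g ⌋} o in k , isYes⇒ found

  iter⇒orbit : ∀ {f g} → Dart f ≡ true → ∀ m → iter step m f ≡ g → orbit f g ≡ true
  iter⇒orbit {f} {g} df m reached with periodic df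
  ... | p , bound , period = ∃<⇒anyBelow {period-bound} {λ k → ⌊ iter step k f ≟ g ⌋} (≤-trans (m%n<n m (suc p)) bound)
                               (⇒isYes (iter step (m % suc p) f ≟ g) (trans (iter-mod step period m) reached))

  orbit-equivalence : IsEquivalenceOn Dart orbit
  orbit-equivalence = record
    { reflexive = λ df → iter⇒orbit df 0 refl
    ; symmetric = symmetric
    ; transitive = transitive
    ; closed = λ df o → let (k , f→g) = orbit⇒iter o in subst (λ g → Dart g ≡ true) f→g (iter-dart k df)
    }
    where
    transitive : ∀ {f g h} → Dart f ≡ true → orbit f g ≡ true → orbit g h ≡ true → orbit f h ≡ true
    transitive {f} df o o′ with orbit⇒iter o | orbit⇒iter o′
    ... | k , f→g | l , g→h =
      iter⇒orbit df (l + k) (trans (iter-+ step l k {f}) (trans (cong (iter step l) f→g) g→h))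
    symmetric : ∀ {f g} → Dart f ≡ true → orbit f g ≡ true → orbit g f ≡ true
    symmetric {f} {g} df o with orbit⇒iter o | periodic df
    ... | k , f→g | p , _ , period = iter⇒orbit (subst (λ g → Dart g ≡ true) f→g (iter-dart k df)) (k * suc p ∸ k)
                                       (subst (λ g → iter step (k * suc p ∸ k) g ≡ f) f→g (iter-return step period k))

  orbitMinimal : (Flag n → ℕ) → Flag n → Bool
  orbitMinimal r f = Dart f ∧ allBelow period-bound (λ k → r f ≤ᵇ r (iter step k f))

  open ClassMinima (Flag-finite n) orbit-equivalence public using (SelectsMinima)

  orbitMinimal-selects : ∀ r → SelectsMinima r (orbitMinimal r)
  orbitMinimal-selects r f = mk⇔
    (λ sel → ∧-elimˡ sel , λ {g} o →
       let (k , k<bound , found) = anyBelow⇒∃< {period-bound} {λ k → ⌊ iter step k f ≟ g ⌋} o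
       in subst (λ g → r f ≤ r g) (isYes⇒ found) (≤ᵇ-true⇒≤ (allBelow⇒∀< {period-bound} (∧-elimʳ {Dart f} sel) k<bound)))
    (λ (df , least) → ∧-intro df (∀<⇒allBelow {period-bound} λ {k} k<bound →
       ≤⇒≤ᵇ-true (least (∃<⇒anyBelow {period-bound} {λ j → ⌊ iter step j f ≟ iter step k f ⌋} k<bound
                                       (⇒isYes (iter step k f ≟ iter step k f) refl)))))

  flagOrbits≡count : flagOrbits R ≡ Finite.count (Flag-finite n) (orbitMinimal code)
  flagOrbits≡count = sumF-cong λ u → sumF-cong λ v → cong (indicator (orbitMinimal code (u , v , false)) +_) (+-identityʳ _)

-- Invariance of Euler genus under relabelling

permutation-injective : ∀ {n} (π : Permutation′ n) → Injective _≡_ _≡_ (π ⟨$⟩ʳ_)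
permutation-injective π {u} {v} e = trans (sym (inverseˡ π)) (trans (cong (π ⟨$⟩ˡ_) e) (inverseˡ π))

record Relabelling {n} (π : Permutation′ n) (H H′ : Graph n) : Set where
  field
    V-relabel : ∀ u → V H′ u ≡ V H (π ⟨$⟩ʳ u)
    E-relabel : ∀ u v → E H′ u v ≡ E H (π ⟨$⟩ʳ u) (π ⟨$⟩ʳ v)

relabelling-flip : ∀ {n π} {H H′ : Graph n} → Relabelling π H H′ → Relabelling (Perm.flip π) H′ H
relabelling-flip {π = π} {H} rel = record
  { V-relabel = λ u → sym (trans (V-relabel (π ⟨$⟩ˡ u)) (cong (V H) (inverseʳ π)))
  ; E-relabel = λ u v → sym (trans (E-relabel (π ⟨$⟩ˡ u) (π ⟨$⟩ˡ v)) (cong₂ (E H) (inverseʳ π) (inverseʳ π)))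
  }
  where open Relabelling rel

relabelling-∘ : ∀ {n π σ} {H H′ H″ : Graph n} →
                Relabelling π H H′ → Relabelling σ H′ H″ → Relabelling (σ ∘ₚ π) H H″
relabelling-∘ {σ = σ} rel rel′ = record
  { V-relabel = λ u → trans (R′.V-relabel u) (R.V-relabel (σ ⟨$⟩ʳ u))
  ; E-relabel = λ u v → trans (R′.E-relabel u v) (R.E-relabel (σ ⟨$⟩ʳ u) (σ ⟨$⟩ʳ v))
  }
  where
  module R = Relabelling rel
  module R′ = Relabelling rel′

WF-relabel : ∀ {n π} {H H′ : Graph n} → WF H → Relabelling π H H′ → WF H′
WF-relabel {π = π} {H} wf rel = record
  { sym = λ u v → trans (E-relabel u v) (trans (WF.sym wf _ _) (sym (E-relabel v u)))
  ; irrefl = λ u → trans (E-relabel u u) (WF.irrefl wf _)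
  ; inV = λ u v e → trans (V-relabel u) (WF.inV wf _ _ (trans (sym (E-relabel u v)) e))
  }
  where open Relabelling rel

nE-twice : ∀ {n} {G : Graph n} → WF G → sumF (λ u → countF (E G u)) ≡ nE G + nE G
nE-twice {n} {G} wf = begin
  sumF (λ u → countF (E G u))                            ≡⟨ sumF-cong (λ u → trans (countF≡sumF (E G u))
                                                                                   (sumF-cong (split u))) ⟩
  sumF (λ u → sumF (λ v → below u v + below v u))        ≡⟨ sumF-cong (λ u → sumF-distrib-+ (below u) (λ v → below v u)) ⟩
  sumF (λ u → sumF (below u) + sumF (λ v → below v u))   ≡⟨ sumF-distrib-+ (λ u → sumF (below u)) _ ⟩
  ordered + sumF (λ u → sumF (λ v → below v u))          ≡⟨ cong (ordered +_) (sumF-comm (λ u v → below v u)) ⟩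
  ordered + ordered                                      ≡⟨ cong₂ _+_ ordered≡nE ordered≡nE ⟩
  nE G + nE G                                            ∎
  where
  open ≡-Reasoning
  below : Fin n → Fin n → ℕ
  below u v = indicator ((toℕ u <ᵇ toℕ v) ∧ E G u v)
  ordered : ℕ
  ordered = sumF (λ u → sumF (below u))
  ordered≡nE : ordered ≡ nE G
  ordered≡nE = sym (sumF-cong λ u → countF≡sumF (λ v → (toℕ u <ᵇ toℕ v) ∧ E G u v))
  split : ∀ u v → indicator (E G u v) ≡ below u v + below v u
  split u v with <-cmp (toℕ u) (toℕ v)
  ... | tri< u<v _ v≮u rewrite <⇒<ᵇ-true u<v | ≢true (v≮u ∘ <ᵇ-true⇒<) = sym (+-identityʳ _)
  ... | tri> u≮v _ v<u rewrite <⇒<ᵇ-true v<u | ≢true (u≮v ∘ <ᵇ-true⇒<) | WF.sym wf v u = refl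
  ... | tri≈ _ u≡v _ rewrite Finₚ.toℕ-injective u≡v | WF.irrefl wf v | Boolₚ.∧-zeroʳ (toℕ v <ᵇ toℕ v) = refl

module Relabel {n} {π : Permutation′ n} {H H′ : Graph n} (wf : WF H) (rel : Relabelling π H H′) where
  open Relabelling rel

  private
    ⟦_⟧ : Fin n → Fin n
    ⟦ u ⟧ = π ⟨$⟩ʳ u

    ⟦_⟧⁻¹ : Fin n → Fin n
    ⟦ u ⟧⁻¹ = π ⟨$⟩ˡ u

    wf′ : WF H′
    wf′ = WF-relabel wf rel

  nV-relabel : nV H′ ≡ nV H
  nV-relabel = trans (countF-cong V-relabel) (countF-permute π (V H))

  nE-relabel : nE H′ ≡ nE H
  nE-relabel = *-cancelˡ-≡ (nE H′) (nE H) 2 (begin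
    2 * nE H′                         ≡⟨ cong (nE H′ +_) (+-identityʳ (nE H′)) ⟩
    nE H′ + nE H′                     ≡⟨ nE-twice wf′ ⟨
    sumF (λ u → countF (E H′ u))      ≡⟨ sumF-cong (λ u → countF-cong (E-relabel u)) ⟩
    sumF (λ u → countF (λ v → E H ⟦ u ⟧ ⟦ v ⟧))  ≡⟨ sumF-cong (λ u → countF-permute π (E H ⟦ u ⟧)) ⟩
    sumF (λ u → countF (E H ⟦ u ⟧))   ≡⟨ sumF-permute π (λ u → countF (E H u)) ⟩
    sumF (λ u → countF (E H u))       ≡⟨ nE-twice wf ⟩
    nE H + nE H                       ≡⟨ cong (nE H +_) (+-identityʳ (nE H)) ⟨
    2 * nE H                          ∎)
    where open ≡-Reasoning

  isolated-relabel : countF (isolated H′) ≡ countF (isolated H)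
  isolated-relabel = trans (countF-cong λ u → cong₂ (λ a b → a ∧ not b) (V-relabel u)
                                                   (trans (anyF-cong (E-relabel u)) (anyF-permute π (E H ⟦ u ⟧))))
                           (countF-permute π (isolated H))

  reach-relabel : ∀ k u v → reachIn H′ k u v ≡ reachIn H k ⟦ u ⟧ ⟦ v ⟧
  reach-relabel zero u v = sym (==-injective ⟦_⟧ (permutation-injective π) u v)
  reach-relabel (suc k) u v = cong₂ _∨_ (reach-relabel k u v)
    (trans (anyF-cong λ w → cong₂ _∧_ (reach-relabel k u w) (E-relabel w v))
           (anyF-permute π (λ w → reachIn H k ⟦ u ⟧ w ∧ E H w ⟦ v ⟧)))

  nC-relabel : nC H′ ≡ nC H
  nC-relabel = begin
    nC H′                                  ≡⟨ countF-cong relabelled ⟩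
    countF (componentLeast r ∘ ⟦_⟧)        ≡⟨ countF-permute π (componentLeast r) ⟩
    countF (componentLeast r)              ≡⟨ countF≡sumF (componentLeast r) ⟩
    count (componentLeast r)               ≡⟨ count-minima-invariant r-injective Finₚ.toℕ-injective
                                                (componentLeast-selects r) (componentLeast-selects toℕ) ⟩
    count (componentLeast toℕ)             ≡⟨ nC≡count ⟨
    nC H                                   ∎
    where
    open ≡-Reasoning
    open Reachability wf
    open Finite (Fin-finite n) using (count)
    open ClassMinima (Fin-finite n) reach-equivalence using (count-minima-invariant)
    r : Fin n → ℕ
    r = toℕ ∘ ⟦_⟧⁻¹
    r-injective : Injective _≡_ _≡_ r
    r-injective e = trans (sym (inverseʳ π)) (trans (cong ⟦_⟧ (Finₚ.toℕ-injective e)) (inverseʳ π))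
    relabelled : ∀ u → (V H′ u ∧ allF (λ v → not (reachIn H′ n u v) ∨ (toℕ u ≤ᵇ toℕ v))) ≡ componentLeast r ⟦ u ⟧
    relabelled u = cong₂ _∧_ (V-relabel u) (trans
      (allF-cong λ v → cong₂ (λ a b → not a ∨ b) (reach-relabel n u v)
                             (cong₂ (λ a b → toℕ a ≤ᵇ toℕ b) (sym (inverseˡ π)) (sym (inverseˡ π))))
      (allF-permute π (λ w → not (reach n ⟦ u ⟧ w) ∨ (r ⟦ u ⟧ ≤ᵇ r w))))

  rotSys : RotSys H → RotSys H′
  rotSys R = record
    { ρ = λ u v → ⟦ ρ R ⟦ u ⟧ ⟦ v ⟧ ⟧⁻¹
    ; ρ' = λ u v → ⟦ ρ' R ⟦ u ⟧ ⟦ v ⟧ ⟧⁻¹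
    ; λs = λ u v → λs R ⟦ u ⟧ ⟦ v ⟧
    ; ρ-nb = λ u v e → neighbour (ρ-nb R _ _ (edge e))
    ; ρ'-nb = λ u v e → neighbour (ρ'-nb R _ _ (edge e))
    ; ρ'ρ = λ u v e → trans (cong (λ w → ⟦ ρ' R ⟦ u ⟧ w ⟧⁻¹) (inverseʳ π))
                            (trans (cong ⟦_⟧⁻¹ (ρ'ρ R _ _ (edge e))) (inverseˡ π))
    ; ρρ' = λ u v e → trans (cong (λ w → ⟦ ρ R ⟦ u ⟧ w ⟧⁻¹) (inverseʳ π))
                            (trans (cong ⟦_⟧⁻¹ (ρρ' R _ _ (edge e))) (inverseˡ π))
    ; cyclic = λ u v w e e′ → let (k , reaches) = cyclic R _ _ _ (edge e) (edge e′) in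
        k , trans (iter-rotation u v k) (trans (cong ⟦_⟧⁻¹ reaches) (inverseˡ π))
    ; λ-sym = λ u v → λ-sym R ⟦ u ⟧ ⟦ v ⟧
    }
    where
    edge : ∀ {u v} → E H′ u v ≡ true → E H ⟦ u ⟧ ⟦ v ⟧ ≡ true
    edge {u} {v} e = trans (sym (E-relabel u v)) e
    neighbour : ∀ {u w} → E H ⟦ u ⟧ w ≡ true → E H′ u ⟦ w ⟧⁻¹ ≡ true
    neighbour {u} {w} e = trans (E-relabel u ⟦ w ⟧⁻¹) (trans (cong (E H ⟦ u ⟧) (inverseʳ π)) e)
    iter-rotation : ∀ u v k → iter (λ w → ⟦ ρ R ⟦ u ⟧ ⟦ w ⟧ ⟧⁻¹) k v ≡ ⟦ iter (ρ R ⟦ u ⟧) k ⟦ v ⟧ ⟧⁻¹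
    iter-rotation u v zero = sym (inverseˡ π)
    iter-rotation u v (suc k) = trans (cong (λ w → ⟦ ρ R ⟦ u ⟧ ⟦ w ⟧ ⟧⁻¹) (iter-rotation u v k))
                                      (cong (λ w → ⟦ ρ R ⟦ u ⟧ w ⟧⁻¹) (inverseʳ π))

  module _ (R : RotSys H) where
    private
      R′ : RotSys H′
      R′ = rotSys R

      ⟦_⟧ᶠ : Flag n → Flag n
      ⟦ u , v , s ⟧ᶠ = ⟦ u ⟧ , ⟦ v ⟧ , s

      ⟦_⟧ᶠ⁻¹ : Flag n → Flag n
      ⟦ u , v , s ⟧ᶠ⁻¹ = ⟦ u ⟧⁻¹ , ⟦ v ⟧⁻¹ , s

      flag-inverseˡ : ∀ f → ⟦ ⟦ f ⟧ᶠ ⟧ᶠ⁻¹ ≡ f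
      flag-inverseˡ (u , v , s) = cong₂ (λ u v → u , v , s) (inverseˡ π) (inverseˡ π)

      flag-inverseʳ : ∀ f → ⟦ ⟦ f ⟧ᶠ⁻¹ ⟧ᶠ ≡ f
      flag-inverseʳ (u , v , s) = cong₂ (λ u v → u , v , s) (inverseʳ π) (inverseʳ π)

      step-relabel : ∀ f → faceStep R′ f ≡ ⟦ faceStep R ⟦ f ⟧ᶠ ⟧ᶠ⁻¹
      step-relabel (u , v , s) = cong₂ _,_ (sym (inverseˡ π))
        (cong (_, s xor λs R ⟦ u ⟧ ⟦ v ⟧) (sym (Boolₚ.if-float ⟦_⟧⁻¹ (s xor λs R ⟦ u ⟧ ⟦ v ⟧))))

      iter-relabel : ∀ k f → iter (faceStep R′) k f ≡ ⟦ iter (faceStep R) k ⟦ f ⟧ᶠ ⟧ᶠ⁻¹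
      iter-relabel zero f = sym (flag-inverseˡ f)
      iter-relabel (suc k) f = begin
        faceStep R′ (iter (faceStep R′) k f)                        ≡⟨ cong (faceStep R′) (iter-relabel k f) ⟩
        faceStep R′ ⟦ g ⟧ᶠ⁻¹                                          ≡⟨ step-relabel ⟦ g ⟧ᶠ⁻¹ ⟩
        ⟦ faceStep R ⟦ ⟦ g ⟧ᶠ⁻¹ ⟧ᶠ ⟧ᶠ⁻¹                                ≡⟨ cong (λ h → ⟦ faceStep R h ⟧ᶠ⁻¹) (flag-inverseʳ g) ⟩
        ⟦ faceStep R g ⟧ᶠ⁻¹                                           ∎
        where
        open ≡-Reasoning
        g : Flag n
        g = iter (faceStep R) k ⟦ f ⟧ᶠ

      open Finite (Flag-finite n) using (count; count-cong)

      count-relabel : ∀ M → count (M ∘ ⟦_⟧ᶠ) ≡ count M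
      count-relabel M = trans (sumF-cong λ u → sumF-permute π (λ v → pair ⟦ u ⟧ v)) (sumF-permute π (λ u → sumF (pair u)))
        where
        pair : Fin n → Fin n → ℕ
        pair u v = indicator (M (u , v , false)) + indicator (M (u , v , true))

    flagOrbits-relabel : flagOrbits R′ ≡ flagOrbits R
    flagOrbits-relabel = begin
      flagOrbits R′                          ≡⟨ O′.flagOrbits≡count ⟩
      count (O′.orbitMinimal code)           ≡⟨ count-cong relabelled ⟩
      count (O.orbitMinimal r ∘ ⟦_⟧ᶠ)        ≡⟨ count-relabel (O.orbitMinimal r) ⟩
      count (O.orbitMinimal r)               ≡⟨ count-minima-invariant r-injective code-injective
                                                  (O.orbitMinimal-selects r) (O.orbitMinimal-selects code) ⟩
      count (O.orbitMinimal code)            ≡⟨ O.flagOrbits≡count ⟨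
      flagOrbits R                           ∎
      where
      open ≡-Reasoning
      module O = FaceOrbits wf R
      module O′ = FaceOrbits wf′ R′
      open ClassMinima (Flag-finite n) O.orbit-equivalence using (count-minima-invariant)
      r : Flag n → ℕ
      r = code ∘ ⟦_⟧ᶠ⁻¹
      r-injective : Injective _≡_ _≡_ r
      r-injective {f} {g} e = trans (sym (flag-inverseʳ f)) (trans (cong ⟦_⟧ᶠ (code-injective e)) (flag-inverseʳ g))
      relabelled : ∀ f → O′.orbitMinimal code f ≡ O.orbitMinimal r ⟦ f ⟧ᶠ
      relabelled f@(u , v , s) = cong₂ _∧_ (E-relabel u v) (allBelow-cong {2 * n * n} λ k →
        cong₂ (λ g h → code g ≤ᵇ code h) (sym (flag-inverseˡ f)) (iter-relabel k f))

    genus-relabel : eulerGenusOf R′ ≡ eulerGenusOf R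
    genus-relabel = cong₂ _∸_ (cong₂ (λ c e → 2 * c + e) nC-relabel nE-relabel)
                              (cong₂ _+_ nV-relabel (cong₂ (λ o i → o ℕ./ 2 + i) flagOrbits-relabel isolated-relabel))

embedsIn-relabel : ∀ {n π} {H H′ : Graph n} {k} → WF H → Relabelling π H H′ → EmbedsIn H k → EmbedsIn H′ k
embedsIn-relabel {k = k} wf rel (R , genus≤k) =
  Relabel.rotSys wf rel R , subst (_≤ k) (sym (Relabel.genus-relabel wf rel R)) genus≤k

_≅_ : ∀ {n} → Graph n → Graph n → Set
H ≅ H′ = ∃ λ π → Relabelling π H H′

embedsIn-≅ : ∀ {n} {H H′ : Graph n} {k} → WF H → H ≅ H′ → EmbedsIn H k ⇔ EmbedsIn H′ k
embedsIn-≅ wf (_ , rel) = mk⇔ (embedsIn-relabel wf rel) (embedsIn-relabel (WF-relabel wf rel) (relabelling-flip rel))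

-- Adding, deleting and contracting edges

module _ {n : ℕ} where

  -- addEdge and deleteEdge use this test inline.
  joins : Fin n → Fin n → Fin n → Fin n → Bool
  joins a b u v = (u == a ∧ v == b) ∨ (u == b ∧ v == a)

  joins⇒ : ∀ a b u v → joins a b u v ≡ true → (u ≡ a × v ≡ b) ⊎ (u ≡ b × v ≡ a)
  joins⇒ a b u v j with ∨-elim {u == a ∧ v == b} j
  ... | inj₁ ab = inj₁ (==⇒≡ (∧-elimˡ ab) , ==⇒≡ (∧-elimʳ {u == a} ab))
  ... | inj₂ ba = inj₂ (==⇒≡ (∧-elimˡ ba) , ==⇒≡ (∧-elimʳ {u == b} ba))

  joins-swap : ∀ a b u v → joins a b u v ≡ joins a b v u
  joins-swap a b u v = trans (cong₂ _∨_ (Boolₚ.∧-comm (u == a) (v == b)) (Boolₚ.∧-comm (u == b) (v == a)))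
                             (Boolₚ.∨-comm (v == b ∧ u == a) (v == a ∧ u == b))

  joins-comm : ∀ a b u v → joins a b u v ≡ joins b a u v
  joins-comm a b u v = Boolₚ.∨-comm (u == a ∧ v == b) (u == b ∧ v == a)

  joins-outside : ∀ {a b u} v → u ≢ a → u ≢ b → joins a b u v ≡ false
  joins-outside {a} {b} {u} v u≢a u≢b = ≢true (Sum.[ u≢a ∘ proj₁ , u≢b ∘ proj₁ ] ∘ joins⇒ a b u v)

  WF-addEdge : ∀ {H : Graph n} {a b} → WF H → V H a ≡ true → V H b ≡ true → a ≢ b → WF (addEdge H a b)
  WF-addEdge {H} {a} {b} wf Va Vb a≢b = record
    { sym = λ u v → cong₂ _∨_ (WF.sym wf u v) (joins-swap a b u v)
    ; irrefl = λ u → ≢true λ e → Sum.[ (λ Euu → true≢false Euu (WF.irrefl wf u)) , loop {u} ] (∨-elim {E H u u} e)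
    ; inV = λ u v e → Sum.[ WF.inV wf u v , endpoint ] (∨-elim {E H u v} e)
    }
    where
    loop : ∀ {u} → joins a b u u ≡ true → ⊥
    loop {u} j with joins⇒ a b u u j
    ... | inj₁ (refl , a≡b) = a≢b a≡b
    ... | inj₂ (refl , b≡a) = a≢b (sym b≡a)
    endpoint : ∀ {u v} → joins a b u v ≡ true → V H u ≡ true
    endpoint {u} {v} j with joins⇒ a b u v j
    ... | inj₁ (refl , _) = Va
    ... | inj₂ (refl , _) = Vb

  WF-deleteEdge : ∀ {H : Graph n} {a b} → WF H → WF (deleteEdge H a b)
  WF-deleteEdge {H} {a} {b} wf = record
    { sym = λ u v → cong₂ (λ e j → e ∧ not j) (WF.sym wf u v) (joins-swap a b u v)
    ; irrefl = λ u → cong (_∧ _) (WF.irrefl wf u)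
    ; inV = λ u v → WF.inV wf u v ∘ ∧-elimˡ
    }

  WF-merge : ∀ {H : Graph n} {a b} → WF H → V H a ≡ true → WF (merge H a b)
  WF-merge {H} {a} {b} wf Va = record
    { sym = λ u v → trans (∧-swap (not (u == b)) (not (v == b)))
                          (cong (λ r → not (v == b) ∧ not (u == b) ∧ r)
                                (cong₂ (λ p q → not p ∧ q) (==-sym u v) (adjacent-sym u v)))
    ; irrefl = λ u → ≢true λ e → true≢false (==-refl u)
                 (not-true⁻ (∧-elimˡ (∧-elimʳ {not (u == b)} (∧-elimʳ {not (u == b)} e))))
    ; inV = λ u v e → ∧-intro (endpoint u v (∧-elimʳ {not (u == v)} (∧-elimʳ {not (v == b)} (∧-elimʳ {not (u == b)} e))))
                              (∧-elimˡ e)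
    }
    where
    adjacent : Fin n → Fin n → Bool
    adjacent u v = E H u v ∨ (u == a ∧ E H b v) ∨ (v == a ∧ E H u b)
    adjacent-sym : ∀ u v → adjacent u v ≡ adjacent v u
    adjacent-sym u v = cong₂ _∨_ (WF.sym wf u v)
      (trans (cong₂ _∨_ (cong (u == a ∧_) (WF.sym wf b v)) (cong (v == a ∧_) (WF.sym wf u b)))
             (Boolₚ.∨-comm (u == a ∧ E H v b) (v == a ∧ E H b u)))
    ∧-swap : ∀ p q {r} → p ∧ q ∧ r ≡ q ∧ p ∧ r
    ∧-swap false false = refl
    ∧-swap false true = refl
    ∧-swap true _ = refl
    endpoint : ∀ u v → adjacent u v ≡ true → V H u ≡ true
    endpoint u v e with ∨-elim {E H u v} e
    ... | inj₁ Euv = WF.inV wf u v Euv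
    ... | inj₂ e′ with ∨-elim {u == a ∧ E H b v} e′
    ...   | inj₁ u=a = subst (λ w → V H w ≡ true) (sym (==⇒≡ (∧-elimˡ u=a))) Va
    ...   | inj₂ v=a = WF.inV wf u b (∧-elimʳ {v == a} v=a)

  _≐_ : Graph n → Graph n → Set
  H ≐ H′ = Relabelling Perm.id H H′

  deleteEdge-addEdge : ∀ (H : Graph n) {x y a b} → ¬ ((a ≡ x × b ≡ y) ⊎ (a ≡ y × b ≡ x)) →
                       deleteEdge (addEdge H x y) a b ≐ addEdge (deleteEdge H a b) x y
  deleteEdge-addEdge H {x} {y} {a} {b} ab≠xy = record
    { V-relabel = λ _ → refl
    ; E-relabel = λ u v → distrib (E H u v) (joins x y u v) (joins a b u v) (kept u v)
    }
    where
    distrib : ∀ e j d → (j ≡ true → d ≡ false) → (e ∧ not d) ∨ j ≡ (e ∨ j) ∧ not d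
    distrib e false d _ = trans (Boolₚ.∨-identityʳ _) (cong (_∧ not d) (sym (Boolₚ.∨-identityʳ e)))
    distrib e true d j⇒¬d rewrite j⇒¬d refl | Boolₚ.∨-zeroʳ (e ∧ true) | Boolₚ.∨-zeroʳ e = refl
    kept : ∀ u v → joins x y u v ≡ true → joins a b u v ≡ false
    kept u v j = ≢true λ d → ab≠xy (same-pair (joins⇒ x y u v j) (joins⇒ a b u v d))
      where
      same-pair : (u ≡ x × v ≡ y) ⊎ (u ≡ y × v ≡ x) → (u ≡ a × v ≡ b) ⊎ (u ≡ b × v ≡ a) →
                  (a ≡ x × b ≡ y) ⊎ (a ≡ y × b ≡ x)
      same-pair (inj₁ (refl , refl)) (inj₁ (refl , refl)) = inj₁ (refl , refl)
      same-pair (inj₁ (refl , refl)) (inj₂ (refl , refl)) = inj₂ (refl , refl)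
      same-pair (inj₂ (refl , refl)) (inj₁ (refl , refl)) = inj₂ (refl , refl)
      same-pair (inj₂ (refl , refl)) (inj₂ (refl , refl)) = inj₁ (refl , refl)

  deleteEdge-addEdge-self : ∀ {H : Graph n} {x y} → WF H → E H x y ≡ false → deleteEdge (addEdge H x y) x y ≐ H
  deleteEdge-addEdge-self {H} {x} {y} wf ¬xy = record
    { V-relabel = λ _ → refl
    ; E-relabel = λ u v → cancel (E H u v) (joins x y u v) (absent u v)
    }
    where
    cancel : ∀ e j → (j ≡ true → e ≡ false) → e ≡ (e ∨ j) ∧ not j
    cancel e false _ = sym (trans (Boolₚ.∧-identityʳ _) (Boolₚ.∨-identityʳ e))
    cancel e true j⇒¬e = trans (j⇒¬e refl) (sym (Boolₚ.∧-zeroʳ (e ∨ true)))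
    absent : ∀ u v → joins x y u v ≡ true → E H u v ≡ false
    absent u v j with joins⇒ x y u v j
    ... | inj₁ (refl , refl) = ¬xy
    ... | inj₂ (refl , refl) = trans (WF.sym wf y x) ¬xy

  deleteEdge-comm : ∀ (H : Graph n) a b → deleteEdge H a b ≐ deleteEdge H b a
  deleteEdge-comm H a b = record
    { V-relabel = λ _ → refl
    ; E-relabel = λ u v → cong (λ j → E H u v ∧ not j) (joins-comm b a u v)
    }

  merge-addEdge : ∀ (H : Graph n) {x y} c {d} → x ≢ y → d ≢ x → d ≢ y →
                  merge (addEdge H x y) c d ≐ addEdge (merge H c d) x y
  merge-addEdge H {x} {y} c {d} x≢y d≢x d≢y = record
    { V-relabel = λ _ → refl
    ; E-relabel = λ u v → trans
        (distrib (not (u == d)) (not (v == d)) (not (u == v)) (E H u v) (joins x y u v) _ (guards u v))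
        (cong (λ r → not (u == d) ∧ not (v == d) ∧ not (u == v) ∧ ((E H u v ∨ joins x y u v) ∨ r))
              (cong₂ (λ p q → (u == c ∧ p) ∨ (v == c ∧ q)) (unchanged-from v) (unchanged-to u)))
    }
    where
    distrib : ∀ p q r e j s → (j ≡ true → p ∧ q ∧ r ≡ true) →
              (p ∧ q ∧ r ∧ (e ∨ s)) ∨ j ≡ p ∧ q ∧ r ∧ ((e ∨ j) ∨ s)
    distrib p q r e false s _ =
      trans (Boolₚ.∨-identityʳ _) (cong (λ t → p ∧ q ∧ r ∧ (t ∨ s)) (sym (Boolₚ.∨-identityʳ e)))
    distrib p q r e true s j⇒pqr with p | q | r | j⇒pqr refl
    ... | true | true | true | _ rewrite Boolₚ.∨-zeroʳ e | Boolₚ.∨-zeroʳ (e ∨ s) = refl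
    unchanged-from : ∀ v → E H d v ≡ E H d v ∨ joins x y d v
    unchanged-from v = sym (trans (cong (E H d v ∨_) (joins-outside v d≢x d≢y)) (Boolₚ.∨-identityʳ _))
    unchanged-to : ∀ u → E H u d ≡ E H u d ∨ joins x y u d
    unchanged-to u = sym (trans (cong (E H u d ∨_) (trans (joins-swap x y u d) (joins-outside u d≢x d≢y)))
                                (Boolₚ.∨-identityʳ _))
    distinct : ∀ {u v} → u ≢ d → v ≢ d → u ≢ v → not (u == d) ∧ not (v == d) ∧ not (u == v) ≡ true
    distinct u≢d v≢d u≢v =
      ∧-intro (not-true (≢⇒==-false u≢d)) (∧-intro (not-true (≢⇒==-false v≢d)) (not-true (≢⇒==-false u≢v)))
    guards : ∀ u v → joins x y u v ≡ true → not (u == d) ∧ not (v == d) ∧ not (u == v) ≡ true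
    guards u v j with joins⇒ x y u v j
    ... | inj₁ (refl , refl) = distinct (d≢x ∘ sym) (d≢y ∘ sym) x≢y
    ... | inj₂ (refl , refl) = distinct (d≢y ∘ sym) (d≢x ∘ sym) (x≢y ∘ sym)

  merge-addEdge-self : ∀ (H : Graph n) x y → merge (addEdge H x y) x y ≐ merge H x y
  merge-addEdge-self H x y = record
    { V-relabel = λ _ → refl
    ; E-relabel = λ u v →
        ∧-cong-if (not (u == y)) λ u≠y → ∧-cong-if (not (v == y)) λ v≠y → ∧-cong-if (not (u == v)) λ u≠v →
        sym (unchanged (≢⇒ u≠y) (≢⇒ v≠y) (≢⇒ u≠v))
    }
    where
    ≢⇒ : ∀ {u v : Fin n} → not (u == v) ≡ true → u ≢ v
    ≢⇒ ne u≡v = true≢false (⇒isYes (_ Fin.≟ _) u≡v) (not-true⁻ ne)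
    drop : ∀ e {j} → j ≡ false → e ∨ j ≡ e
    drop e refl = Boolₚ.∨-identityʳ e
    unchanged : ∀ {u v} → u ≢ y → v ≢ y → u ≢ v →
                (E H u v ∨ joins x y u v) ∨ (u == x ∧ (E H y v ∨ joins x y y v)) ∨ (v == x ∧ (E H u y ∨ joins x y u y))
                ≡ E H u v ∨ (u == x ∧ E H y v) ∨ (v == x ∧ E H u y)
    unchanged {u} {v} u≢y v≢y u≢v = cong₂ _∨_ (drop (E H u v) not-uv)
      (cong₂ _∨_ (∧-cong-if (u == x) λ u=x → drop (E H y v) (not-yv (==⇒≡ u=x)))
                 (∧-cong-if (v == x) λ v=x → drop (E H u y) (not-uy (==⇒≡ v=x))))
      where
      not-uv : joins x y u v ≡ false
      not-uv = ≢true λ j → Sum.[ v≢y ∘ proj₂ , u≢y ∘ proj₁ ] (joins⇒ x y u v j)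
      not-yv : u ≡ x → joins x y y v ≡ false
      not-yv u≡x = ≢true λ j → Sum.[ v≢y ∘ proj₂ , (λ (_ , v≡x) → u≢v (trans u≡x (sym v≡x))) ] (joins⇒ x y y v j)
      not-uy : v ≡ x → joins x y u y ≡ false
      not-uy v≡x = ≢true λ j → Sum.[ (λ (u≡x , _) → u≢v (trans u≡x (sym v≡x))) , u≢y ∘ proj₁ ] (joins⇒ x y u y j)

  private
    data Position (a b : Fin n) : Fin n → Set where
      at-a : Position a b a
      at-b : Position a b b
      elsewhere : ∀ {u} → u ≢ a → u ≢ b → Position a b u

    position : ∀ a b u → Position a b u
    position a b u with u Fin.≟ a | u Fin.≟ b
    ... | yes refl | _ = at-a
    ... | no _ | yes refl = at-b
    ... | no u≢a | no u≢b = elsewhere u≢a u≢b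

    transpose-a : ∀ (a b : Fin n) → Perm.transpose a b ⟨$⟩ʳ a ≡ b
    transpose-a a b rewrite dec-true (a Fin.≟ a) refl = refl

    transpose-b : ∀ (a b : Fin n) → Perm.transpose a b ⟨$⟩ʳ b ≡ a
    transpose-b a b with b Fin.≟ a
    ... | yes b≡a = b≡a
    ... | no _ rewrite dec-true (b Fin.≟ b) refl = refl

    transpose-elsewhere : ∀ {a b u : Fin n} → u ≢ a → u ≢ b → Perm.transpose a b ⟨$⟩ʳ u ≡ u
    transpose-elsewhere {a} {b} {u} u≢a u≢b rewrite dec-false (u Fin.≟ a) u≢a | dec-false (u Fin.≟ b) u≢b = refl

  merge-transpose : ∀ (H : Graph n) {a b} → a ≢ b → V H a ≡ V H b →
                    Relabelling (Perm.transpose a b) (merge H a b) (merge H b a)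
  merge-transpose H {a} {b} a≢b Va≡Vb = record
    { V-relabel = vertices (transpose-a a b) (transpose-b a b) transpose-elsewhere
    ; E-relabel = edges (transpose-a a b) (transpose-b a b) transpose-elsewhere
    }
    where
    a≠b : (a == b) ≡ false
    a≠b = ≢⇒==-false a≢b
    b≠a : (b == a) ≡ false
    b≠a = ≢⇒==-false (a≢b ∘ sym)
    ∨-swap : ∀ p q {r} → p ∨ q ∨ r ≡ q ∨ p ∨ r
    ∨-swap false false = refl
    ∨-swap false true = refl
    ∨-swap true false = refl
    ∨-swap true true = refl
    module _ {τ : Fin n → Fin n} (τa : τ a ≡ b) (τb : τ b ≡ a)
             (τ-elsewhere : ∀ {u} → u ≢ a → u ≢ b → τ u ≡ u) where
      vertices : ∀ u → V (merge H b a) u ≡ V (merge H a b) (τ u)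
      vertices u with position a b u
      ... | at-a rewrite τa | ==-refl a | ==-refl b = trans (Boolₚ.∧-zeroʳ (V H a)) (sym (Boolₚ.∧-zeroʳ (V H b)))
      ... | at-b rewrite τb | a≠b | b≠a =
        trans (Boolₚ.∧-identityʳ (V H b)) (trans (sym Va≡Vb) (sym (Boolₚ.∧-identityʳ (V H a))))
      ... | elsewhere u≢a u≢b rewrite τ-elsewhere u≢a u≢b | ≢⇒==-false u≢a | ≢⇒==-false u≢b = refl

      edges : ∀ u v → E (merge H b a) u v ≡ E (merge H a b) (τ u) (τ v)
      edges u v with position a b u | position a b v
      ... | at-a | _ rewrite τa | ==-refl a | ==-refl b = refl
      ... | at-b | at-a rewrite τb | τa | ==-refl a | ==-refl b | a≠b | b≠a = refl
      ... | at-b | at-b rewrite τb | ==-refl a | ==-refl b | a≠b | b≠a = refl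
      ... | at-b | elsewhere v≢a v≢b
        rewrite τb | τ-elsewhere v≢a v≢b | a≠b | b≠a | ==-refl a | ==-refl b
              | ≢⇒==-false v≢a | ≢⇒==-false v≢b | ≢⇒==-false (v≢a ∘ sym) | ≢⇒==-false (v≢b ∘ sym)
        = ∨-swap (E H b v) (E H a v)
      ... | elsewhere u≢a u≢b | at-a rewrite τ-elsewhere u≢a u≢b | τa | ==-refl a | ==-refl b
              | ≢⇒==-false u≢a | ≢⇒==-false u≢b = refl
      ... | elsewhere u≢a u≢b | at-b rewrite τ-elsewhere u≢a u≢b | τb | ==-refl a | ==-refl b
              | ≢⇒==-false u≢a | ≢⇒==-false u≢b | a≠b | b≠a = Boolₚ.∨-comm (E H u b) (E H u a)
      ... | elsewhere u≢a u≢b | elsewhere v≢a v≢b rewrite τ-elsewhere u≢a u≢b | τ-elsewhere v≢a v≢b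
              | ≢⇒==-false u≢a | ≢⇒==-false u≢b | ≢⇒==-false v≢a | ≢⇒==-false v≢b = refl

-- Criticality of Ĝ⁺

embedsIn-mono : ∀ {n} {H : Graph n} {k l} → k ≤ l → EmbedsIn H k → EmbedsIn H l
embedsIn-mono k≤l (R , genus≤k) = R , ≤-trans genus≤k k≤l

¬embedsIn-⊔ : ∀ {n} {H : Graph n} {k l} → ¬ EmbedsIn H k → ¬ EmbedsIn H l → ¬ EmbedsIn H (k ⊔ l)
¬embedsIn-⊔ {k = k} {l} ¬k ¬l with ⊔-sel k l
... | inj₁ k⊔l≡k rewrite k⊔l≡k = ¬k
... | inj₂ k⊔l≡l rewrite k⊔l≡l = ¬l

uniform-bound : ∀ {m} {Good : ℕ → Set} (B : Fin m → ℕ → Set) →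
                (∀ {k l} → Good k → Good l → Good (k ⊔ l)) → (∀ {i k l} → k ≤ l → B i k → B i l) →
                ∀ {k₀} → Good k₀ → (∀ i → ∃ λ k → Good k × B i k) → ∃ λ K → Good K × ∀ i → B i K
uniform-bound {zero} B _ _ {k₀} good₀ _ = k₀ , good₀ , λ ()
uniform-bound {suc m} B good-⊔ mono good₀ bounds =
  let (k , good , Bk) = bounds Fin.zero
      (K , goodK , BK) = uniform-bound (B ∘ Fin.suc) good-⊔ mono good₀ (bounds ∘ Fin.suc)
  in k ⊔ K , good-⊔ good goodK , λ { Fin.zero → mono (m≤m⊔n k K) Bk ; (Fin.suc i) → mono (m≤n⊔m k K) (BK i) }

EdgeMinorsEmbed : ∀ {n} → Graph n → ℕ → Fin n → Fin n → Set
EdgeMinorsEmbed H k a b = E H a b ≡ true → EmbedsIn (deleteEdge H a b) k × EmbedsIn (merge H a b) k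

edgeMinorsEmbed-mono : ∀ {n} {H : Graph n} {a b k l} → k ≤ l → EdgeMinorsEmbed H k a b → EdgeMinorsEmbed H l a b
edgeMinorsEmbed-mono k≤l minors e =
  let (deleted , merged) = minors e in embedsIn-mono k≤l deleted , embedsIn-mono k≤l merged

module OneEdgeMinors {n} (G : TGraph n) (G° : InGxy° G) where
  private
    U P : Graph n
    U = under G
    P = plusU G

    wfU : WF U
    wfU = proj₁ (proj₁ G°)

    x≢y : x G ≢ y G
    x≢y = proj₁ (proj₂ (proj₁ G°))

    Vx : V U (x G) ≡ true
    Vx = proj₁ (proj₂ (proj₂ (proj₁ G°)))

    Vy : V U (y G) ≡ true
    Vy = proj₂ (proj₂ (proj₂ (proj₁ G°)))

    ¬Exy : E U (x G) (y G) ≡ false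
    ¬Exy = proj₂ G°

    wfP : WF P
    wfP = WF-addEdge wfU Vx Vy x≢y

    edge-endpoints : ∀ {a b} → E U a b ≡ true → V P a ≡ true × V P b ≡ true
    edge-endpoints {a} {b} e = WF.inV wfU a b e , WF.inV wfU b a (trans (WF.sym wfU b a) e)

    edge-distinct : ∀ {a b} → E U a b ≡ true → a ≢ b
    edge-distinct {a} e refl = true≢false e (WF.irrefl wfU a)

    not-xy : ∀ {a b} → E U a b ≡ true → ¬ ((a ≡ x G × b ≡ y G) ⊎ (a ≡ y G × b ≡ x G))
    not-xy e (inj₁ (refl , refl)) = true≢false e ¬Exy
    not-xy e (inj₂ (refl , refl)) = true≢false e (trans (WF.sym wfU _ _) ¬Exy)

    nonterminal : ∀ {b} → isTerminal G b ≡ false → b ≢ x G × b ≢ y G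
    nonterminal {b} t = (λ b≡x → true≢false (∨-introˡ (⇒isYes (b Fin.≟ x G) b≡x)) t)
                      , (λ b≡y → true≢false (∨-introʳ {b == x G} (⇒isYes (b Fin.≟ y G) b≡y)) t)

    terminal-partner : ∀ {a b} → E U a b ≡ true → isTerminal G b ≡ true → a ≢ x G × a ≢ y G
    terminal-partner {a} {b} e t with ∨-elim {b == x G} t
    ... | inj₁ b=x = (λ a≡x → edge-distinct e (trans a≡x (sym (==⇒≡ b=x))))
                   , (λ a≡y → not-xy e (inj₂ (a≡y , ==⇒≡ b=x)))
    ... | inj₂ b=y = (λ a≡x → not-xy e (inj₁ (a≡x , ==⇒≡ b=y)))
                   , (λ a≡y → edge-distinct e (trans a≡y (sym (==⇒≡ b=y))))

  deleteEdge-minor : ∀ {a b} (e : E U a b ≡ true) → deleteEdge P a b ≅ plusU (applyOp {G = G} (del a b e))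
  deleteEdge-minor e = Perm.id , deleteEdge-addEdge U (not-xy e)

  merge-minor : ∀ {a b} (e : E U a b ≡ true) ab≠xy → merge P a b ≅ plusU (applyOp {G = G} (con a b e ab≠xy))
  merge-minor {a} {b} e _ = unfolded
    where
    unfolded : merge P a b ≅ addEdge (if isTerminal G b then merge U b a else merge U a b) (x G) (y G)
    unfolded with isTerminal G b in t
    ... | false = Perm.id , merge-addEdge U a x≢y (proj₁ (nonterminal t)) (proj₂ (nonterminal t))
    ... | true = _ , relabelling-∘ (merge-transpose P (edge-distinct e) (trans Va (sym Vb)))
                                   (merge-addEdge U b x≢y (proj₁ (terminal-partner e t)) (proj₂ (terminal-partner e t)))
      where
      Va : V P a ≡ true
      Va = proj₁ (edge-endpoints e)
      Vb : V P b ≡ true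
      Vb = proj₂ (edge-endpoints e)

  deleteEdge-xy : deleteEdge P (x G) (y G) ≅ U
  deleteEdge-xy = Perm.id , deleteEdge-addEdge-self wfU ¬Exy

  deleteEdge-yx : deleteEdge P (y G) (x G) ≅ U
  deleteEdge-yx = _ , relabelling-∘ (deleteEdge-comm P (y G) (x G)) (deleteEdge-addEdge-self wfU ¬Exy)

  merge-xy : merge P (x G) (y G) ≅ identXY G
  merge-xy = Perm.id , merge-addEdge-self U (x G) (y G)

  merge-yx : merge P (y G) (x G) ≅ identXY G
  merge-yx = _ , relabelling-∘ (merge-transpose P (x≢y ∘ sym) (trans Vy (sym Vx))) (merge-addEdge-self U (x G) (y G))

  private
    open Equivalence

    wf-merge : ∀ {a b} → E P a b ≡ true → WF (merge P a b)
    wf-merge {a} {b} e = WF-merge wfP (WF.inV wfP a b e)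

    xy-edge : E P (x G) (y G) ≡ true
    xy-edge = ∨-introʳ {E U (x G) (y G)} (∨-introˡ (∧-intro (==-refl (x G)) (==-refl (y G))))

  module _ {k} (minors : ∀ a b → EdgeMinorsEmbed P k a b) where
    minors⇒op : ∀ μ → EmbedsIn (plusU (applyOp {G = G} μ)) k
    minors⇒op (del a b e) =
      to (embedsIn-≅ (WF-deleteEdge wfP) (deleteEdge-minor e)) (proj₁ (minors a b (∨-introˡ e)))
    minors⇒op (con a b e ab≠xy) =
      to (embedsIn-≅ (wf-merge (∨-introˡ e)) (merge-minor e ab≠xy)) (proj₂ (minors a b (∨-introˡ e)))

    minors⇒under : EmbedsIn U k
    minors⇒under = to (embedsIn-≅ (WF-deleteEdge wfP) deleteEdge-xy) (proj₁ (minors (x G) (y G) xy-edge))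

    minors⇒identXY : EmbedsIn (identXY G) k
    minors⇒identXY = to (embedsIn-≅ (wf-merge xy-edge) merge-xy) (proj₂ (minors (x G) (y G) xy-edge))

  edge-bound : InC° G × θPos G × identXY G <ᵍ P → ∀ a b → ∃ λ k → ¬ EmbedsIn P k × EdgeMinorsEmbed P k a b
  edge-bound ((_ , ops) , (k₁ , U∈k₁ , P∉k₁) , (k₂ , I∈k₂ , P∉k₂)) a b with E U a b in e
  ... | true = let (kd , del∈ , P∉kd) = ops (del a b e) ; (kc , con∈ , P∉kc) = ops (con a b e (not-xy e)) in
    kd ⊔ kc , ¬embedsIn-⊔ P∉kd P∉kc , λ _ →
      embedsIn-mono (m≤m⊔n kd kc) (from (embedsIn-≅ (WF-deleteEdge wfP) (deleteEdge-minor e)) del∈) ,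
      embedsIn-mono (m≤n⊔m kd kc) (from (embedsIn-≅ (wf-merge (∨-introˡ e)) (merge-minor e (not-xy e))) con∈)
  ... | false = k₁ ⊔ k₂ , ¬embedsIn-⊔ P∉k₁ P∉k₂ , λ eP →
    xy-minors (joins⇒ (x G) (y G) a b eP)
    where
    xy-minors : (a ≡ x G × b ≡ y G) ⊎ (a ≡ y G × b ≡ x G) →
                EmbedsIn (deleteEdge P a b) (k₁ ⊔ k₂) × EmbedsIn (merge P a b) (k₁ ⊔ k₂)
    xy-minors (inj₁ (refl , refl)) =
      embedsIn-mono (m≤m⊔n k₁ k₂) (from (embedsIn-≅ (WF-deleteEdge wfP) deleteEdge-xy) U∈k₁) ,
      embedsIn-mono (m≤n⊔m k₁ k₂) (from (embedsIn-≅ (WF-merge wfP Vx) merge-xy) I∈k₂)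
    xy-minors (inj₂ (refl , refl)) =
      embedsIn-mono (m≤m⊔n k₁ k₂) (from (embedsIn-≅ (WF-deleteEdge wfP) deleteEdge-yx) U∈k₁) ,
      embedsIn-mono (m≤n⊔m k₁ k₂) (from (embedsIn-≅ (WF-merge wfP Vy) merge-yx) I∈k₂)

  uniform-edge-bound : InC° G × θPos G × identXY G <ᵍ P →
                       ∃ λ K → ¬ EmbedsIn P K × ∀ a b → EdgeMinorsEmbed P K a b
  uniform-edge-bound conditions@(_ , (k₁ , _ , P∉k₁) , _) =
    uniform-bound (λ a K → ∀ b → EdgeMinorsEmbed P K a b) ¬embedsIn-⊔
                  (λ k≤l minors b → edgeMinorsEmbed-mono k≤l (minors b)) P∉k₁ λ a →
    uniform-bound (λ b K → EdgeMinorsEmbed P K a b) ¬embedsIn-⊔ edgeMinorsEmbed-mono P∉k₁ (edge-bound conditions a)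

lemma4p2 : ∀ {n : ℕ} (G : TGraph n) → InGxy° G →
    (Critical (plusU G) ⇔ (InC° G × θPos G × identXY G <ᵍ plusU G))
lemma4p2 G G° = mk⇔
  (λ (k , P∉k , minors) → (G° , λ μ → k , minors⇒op minors μ , P∉k)
                        , (k , minors⇒under minors , P∉k)
                        , (k , minors⇒identXY minors , P∉k))
  uniform-edge-bound
  where open OneEdgeMinors G G°
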